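{- Let $q$ be a prime power and $V_{\mathrm s}$ the space of symmetric $3\times3$ matrices over $\mathbb{F}_q$. Every point $P$ of rank $3$ in $\mathrm{PG}(V_{\mathrm s})$ lies on exactly $q^2$ lines of $\mathrm{PG}(V_{\mathrm s})$ having rank distribution $[1,1,q-1]$ and on exactly $q+1$ lines having rank distribution $[1,0,q]$.
   Context: The rank of a point is the rank of a representing matrix. The rank distribution of a line is $[a_1,a_2,a_3]$, where $a_i$ is the number of its points of rank $i$. -}

module Defs where

open import Level using (Level; _⊔_; Lift)
open import Algebra.Bundles using (CommutativeRing)
open import Data.Nat using (ℕ; zero; suc; _^_)
open import Data.Nat.Primality using (Prime)
open import Data.Fin using (Fin) renaming (zero to fz; suc to fs)
open import Data.Product using (Σ; ∃; ∃₂; _×_; _,_)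
open import Data.Empty using (⊥)
open import Data.Unit using (⊤)
open import Relation.Nullary using (¬_)
open import Relation.Binary.PropositionalEquality using (_≡_)
open import Relation.Binary.Definitions using (Decidable)

IsPrimePower : ℕ → Set
IsPrimePower q = Σ ℕ λ p → Σ ℕ λ k → Prime p × (q ≡ p ^ suc k)

-- "exactly n elements of A (up to the equivalence E) satisfy Pr":
-- an enumeration by Fin n of pairwise inequivalent elements satisfying Pr
-- which represents every element satisfying Pr.
Exactly : ∀ {a e p} (A : Set a) (E : A → A → Set e) (Pr : A → Set p) → ℕ → Set (a ⊔ e ⊔ p)
Exactly A E Pr n =
  Σ (Fin n → A) λ f →
    (∀ i → Pr (f i)) ×
    (∀ i j → E (f i) (f j) → i ≡ j) ×
    (∀ x → Pr x → ∃ λ i → E x (f i))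

module FieldDefs {c ℓ} (R : CommutativeRing c ℓ) where
  open CommutativeRing R hiding (zero)

  IsField : Set (c ⊔ ℓ)
  IsField = (¬ 1# ≈ 0#) × (∀ x → ¬ x ≈ 0# → ∃ λ y → x * y ≈ 1#)

  HasCard : ℕ → Set (c ⊔ ℓ)
  HasCard q = Exactly Carrier _≈_ (λ _ → Lift ℓ ⊤) q

  IsFiniteField : ℕ → Set (c ⊔ ℓ)
  IsFiniteField q = IsField × HasCard q × Decidable _≈_

module SymGeometry {c ℓ} (R : CommutativeRing c ℓ) where
  open CommutativeRing R hiding (zero)

  Mat : Set c
  Mat = Fin 3 → Fin 3 → Carrier

  record Vs : Set (c ⊔ ℓ) where
    constructor mkVs
    field
      mat : Mat
      sym : ∀ i j → mat i j ≈ mat j i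
  open Vs public

  _≋_ : Vs → Vs → Set ℓ
  A ≋ B = ∀ i j → mat A i j ≈ mat B i j

  IsZero : Vs → Set ℓ
  IsZero A = ∀ i j → mat A i j ≈ 0#

  InSpan : Vs → Vs → Vs → Set (c ⊔ ℓ)
  InSpan A U W = ∃₂ λ a b → ∀ i j → mat A i j ≈ a * mat U i j + b * mat W i j

  minor2 : Mat → Fin 3 → Fin 3 → Fin 3 → Fin 3 → Carrier
  minor2 M i j k l = M i k * M j l - M i l * M j k

  det3 : Mat → Carrier
  det3 M =
      M 0F 0F * (M 1F 1F * M 2F 2F - M 1F 2F * M 2F 1F)
    - M 0F 1F * (M 1F 0F * M 2F 2F - M 1F 2F * M 2F 0F)
    + M 0F 2F * (M 1F 0F * M 2F 1F - M 1F 1F * M 2F 0F)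
    where
      0F 1F 2F : Fin 3
      0F = fz
      1F = fs fz
      2F = fs (fs fz)

  -- rank (determinantal rank: largest r with a nonzero r×r minor)
  HasRank : Mat → ℕ → Set ℓ
  HasRank M 0 = ∀ i j → M i j ≈ 0#
  HasRank M 1 = (∃₂ λ i j → ¬ M i j ≈ 0#) ×
                 (∀ i j k l → minor2 M i j k l ≈ 0#)
  HasRank M 2 = (∃₂ λ i j → ∃₂ λ k l → ¬ minor2 M i j k l ≈ 0#) ×
                 det3 M ≈ 0#
  HasRank M 3 = ¬ det3 M ≈ 0#
  HasRank M (suc (suc (suc (suc _)))) = Lift ℓ ⊥

  -- points of PG(V_s): nonzero symmetric matrices up to nonzero scalars
  record Point : Set (c ⊔ ℓ) where
    constructor mkPoint
    field
      vec : Vs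
      nonzero : ¬ IsZero vec
  open Point public

  SamePoint : Point → Point → Set (c ⊔ ℓ)
  SamePoint P Q = ∃ λ t → (¬ t ≈ 0#) × (∀ i j → mat (vec Q) i j ≈ t * mat (vec P) i j)

  PointRank : Point → ℕ → Set ℓ
  PointRank P r = HasRank (mat (vec P)) r

  -- lines of PG(V_s): 2-dimensional subspaces, given by a basis
  record Line : Set (c ⊔ ℓ) where
    constructor mkLine
    field
      u v : Vs
      indep : ∀ a b → (∀ i j → a * mat u i j + b * mat v i j ≈ 0#) → (a ≈ 0#) × (b ≈ 0#)
  open Line public

  OnLine : Point → Line → Set (c ⊔ ℓ)
  OnLine P L = InSpan (vec P) (u L) (v L)

  SameLine : Line → Line → Set (c ⊔ ℓ)
  SameLine L M = ∀ P → (OnLine P L → OnLine P M) × (OnLine P M → OnLine P L)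

  PointsOfRank : Line → ℕ → ℕ → Set (c ⊔ ℓ)
  PointsOfRank L r n = Exactly Point SamePoint (λ P → OnLine P L × PointRank P r) n

  RankDistribution : Line → ℕ → ℕ → ℕ → Set (c ⊔ ℓ)
  RankDistribution L a₁ a₂ a₃ =
    PointsOfRank L 1 a₁ × PointsOfRank L 2 a₂ × PointsOfRank L 3 a₃

  LinesThroughWithDist : Point → ℕ → ℕ → ℕ → ℕ → Set (c ⊔ ℓ)
  LinesThroughWithDist P a₁ a₂ a₃ n =
    Exactly Line SameLine (λ L → OnLine P L × RankDistribution L a₁ a₂ a₃) n

-- Let QA(x) = xᵀ adj(P) x.  A line
-- through P whose rank distribution starts with a 1 is L(x) = ⟨x xᵀ, P⟩ for
-- a unique x ∈ PG(2,q); its other points are P + t x xᵀ (t ∈ F), and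
--     det (P + t x xᵀ) = det P + t QA(x),
-- so L(x) has type [1,1,q−1] if QA(x) ≠ 0 and type [1,0,q] if QA(x) = 0.
-- As det adj(P) = (det P)² ≠ 0 the conic QA = 0 has q + 1 points, and the
-- other q² points of PG(2,q) give the lines of type [1,1,q−1].
module Submission where

open import Level using (Level; _⊔_; lift)
open import Algebra.Bundles using (CommutativeRing)
open import Data.Nat as ℕ using (ℕ; zero; suc; _≤_; z≤n; s≤s; _∸_; _^_)
import Data.Nat.Properties as ℕP
open import Data.Integer as ℤ using (ℤ; +_; -[1+_]; _⊖_)
import Data.Integer.Properties as ℤP
open import Data.Sign as Sign using (Sign)
open import Data.Fin as Fin using (Fin; splitAt; join; remQuot; combine; punchOut) renaming (zero to fz; suc to fs)
import Data.Fin.Properties as FinP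
open import Data.Product using (Σ; ∃; ∃₂; _×_; _,_; proj₁; proj₂; uncurry)
open import Data.Sum using (_⊎_; inj₁; inj₂; [_,_]; map; map₁)
open import Data.Empty using (⊥; ⊥-elim)
open import Data.Unit using (⊤; tt)
open import Data.Maybe using (Maybe; just; nothing)
open import Function using (_∘_; id)
open import Relation.Nullary using (¬_; Dec; yes; no)
open import Relation.Binary.Definitions using (Decidable)
open import Relation.Binary.PropositionalEquality as ≡ using (_≡_; _≢_)
open import Defs

-- Instantiating the standard ring solver with ℤ as
-- coefficient ring gives a decision procedure for polynomial identities
-- (with integer constants) in an arbitrary commutative ring.
module IntegerSolver {c ℓ} (R : CommutativeRing c ℓ) where
  open CommutativeRing R
  open import Relation.Binary.Reasoning.Setoid setoid
  open import Algebra.Properties.Ring ring using (-‿involutive; -‿distribˡ-*; -‿distribʳ-*; -0#≈0#; -‿+-comm)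
  open import Algebra.Properties.Semiring.Mult.TCOptimised semiring using (1+×; ×-homo-+; ×1-homo-*) renaming (_×_ to _times_)
  open import Algebra.Solver.Ring.AlmostCommutativeRing using (fromCommutativeRing; _-Raw-AlmostCommutative⟶_)

  nat : ℕ → Carrier
  nat n = n times 1#

  ⟦_⟧ℤ : ℤ → Carrier
  ⟦ + n ⟧ℤ = nat n
  ⟦ -[1+ n ] ⟧ℤ = - nat (suc n)

  shift-sub : ∀ a b → a - b ≈ (1# + a) - (1# + b)
  shift-sub a b = sym (begin
    (1# + a) - (1# + b)      ≈⟨ +-congˡ (sym (-‿+-comm 1# b)) ⟩
    (1# + a) + (- 1# + - b)  ≈⟨ sym (+-assoc _ _ _) ⟩
    ((1# + a) + - 1#) + - b  ≈⟨ +-congʳ (begin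
        (1# + a) + - 1#  ≈⟨ +-congʳ (+-comm 1# a) ⟩
        (a + 1#) + - 1#  ≈⟨ +-assoc _ _ _ ⟩
        a + (1# + - 1#)  ≈⟨ +-congˡ (-‿inverseʳ 1#) ⟩
        a + 0#           ≈⟨ +-identityʳ a ⟩
        a                ∎) ⟩
    a - b                    ∎)

  ⊖-homo : ∀ m n → ⟦ m ⊖ n ⟧ℤ ≈ nat m - nat n
  ⊖-homo zero    zero    = sym (trans (+-congˡ -0#≈0#) (+-identityʳ _))
  ⊖-homo zero    (suc n) = sym (+-identityˡ _)
  ⊖-homo (suc m) zero    = sym (trans (+-congˡ -0#≈0#) (+-identityʳ _))
  ⊖-homo (suc m) (suc n) = begin
    ⟦ suc m ⊖ suc n ⟧ℤ            ≡⟨ ≡.cong ⟦_⟧ℤ (ℤP.[1+m]⊖[1+n]≡m⊖n m n) ⟩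
    ⟦ m ⊖ n ⟧ℤ                    ≈⟨ ⊖-homo m n ⟩
    nat m - nat n                 ≈⟨ shift-sub _ _ ⟩
    (1# + nat m) - (1# + nat n)   ≈⟨ sym (+-cong (1+× m 1#) (-‿cong (1+× n 1#))) ⟩
    nat (suc m) - nat (suc n)     ∎

  +-homo : ∀ i j → ⟦ i ℤ.+ j ⟧ℤ ≈ ⟦ i ⟧ℤ + ⟦ j ⟧ℤ
  +-homo (+ m)    (+ n)    = ×-homo-+ 1# m n
  +-homo (+ m)    -[1+ n ] = ⊖-homo m (suc n)
  +-homo -[1+ m ] (+ n)    = trans (⊖-homo n (suc m)) (+-comm _ _)
  +-homo -[1+ m ] -[1+ n ] = begin
    - nat (suc (suc (m ℕ.+ n)))    ≡⟨ ≡.cong (λ k → - nat (suc k)) (≡.sym (ℕP.+-suc m n)) ⟩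
    - nat (suc m ℕ.+ suc n)        ≈⟨ -‿cong (×-homo-+ 1# (suc m) (suc n)) ⟩
    - (nat (suc m) + nat (suc n))  ≈⟨ sym (-‿+-comm _ _) ⟩
    - nat (suc m) + - nat (suc n)  ∎

  -‿homo : ∀ i → ⟦ ℤ.- i ⟧ℤ ≈ - ⟦ i ⟧ℤ
  -‿homo (+ zero)  = sym -0#≈0#
  -‿homo (+ suc n) = refl
  -‿homo -[1+ n ]  = sym (-‿involutive _)

  -- multiplication is handled through the sign/absolute-value view i = s ◃ ∣i∣
  signed : Sign → Carrier → Carrier
  signed Sign.+ x = x
  signed Sign.- x = - x

  signed-cong : ∀ s {x y} → x ≈ y → signed s x ≈ signed s y
  signed-cong Sign.+ e = e
  signed-cong Sign.- e = -‿cong e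

  ◃-homo : ∀ s n → ⟦ s ℤ.◃ n ⟧ℤ ≈ signed s (nat n)
  ◃-homo Sign.+ zero    = refl
  ◃-homo Sign.- zero    = sym -0#≈0#
  ◃-homo Sign.+ (suc n) = refl
  ◃-homo Sign.- (suc n) = refl

  sign-abs : ∀ i → ⟦ i ⟧ℤ ≈ signed (ℤ.sign i) (nat ℤ.∣ i ∣)
  sign-abs (+ n)    = refl
  sign-abs -[1+ n ] = refl

  signed-* : ∀ s t x y → signed s x * signed t y ≈ signed (s Sign.* t) (x * y)
  signed-* Sign.+ Sign.+ x y = refl
  signed-* Sign.+ Sign.- x y = sym (-‿distribʳ-* x y)
  signed-* Sign.- Sign.+ x y = sym (-‿distribˡ-* x y)
  signed-* Sign.- Sign.- x y =
    trans (sym (-‿distribˡ-* x (- y))) (trans (-‿cong (sym (-‿distribʳ-* x y))) (-‿involutive _))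

  *-homo : ∀ i j → ⟦ i ℤ.* j ⟧ℤ ≈ ⟦ i ⟧ℤ * ⟦ j ⟧ℤ
  *-homo i j = begin
    ⟦ i ℤ.* j ⟧ℤ                                        ≈⟨ ◃-homo (ℤ.sign i Sign.* ℤ.sign j) (ℤ.∣ i ∣ ℕ.* ℤ.∣ j ∣) ⟩
    signed (ℤ.sign i Sign.* ℤ.sign j) (nat (ℤ.∣ i ∣ ℕ.* ℤ.∣ j ∣))
                                                          ≈⟨ signed-cong (ℤ.sign i Sign.* ℤ.sign j) (×1-homo-* ℤ.∣ i ∣ ℤ.∣ j ∣) ⟩
    signed (ℤ.sign i Sign.* ℤ.sign j) (nat ℤ.∣ i ∣ * nat ℤ.∣ j ∣)
                                                          ≈⟨ sym (signed-* (ℤ.sign i) (ℤ.sign j) _ _) ⟩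
    signed (ℤ.sign i) (nat ℤ.∣ i ∣) * signed (ℤ.sign j) (nat ℤ.∣ j ∣)
                                                          ≈⟨ sym (*-cong (sign-abs i) (sign-abs j)) ⟩
    ⟦ i ⟧ℤ * ⟦ j ⟧ℤ                                      ∎

  homomorphism : ℤ.+-*-rawRing -Raw-AlmostCommutative⟶ fromCommutativeRing R
  homomorphism = record
    { ⟦_⟧ = ⟦_⟧ℤ ; +-homo = +-homo ; *-homo = *-homo ; -‿homo = -‿homo
    ; 0-homo = refl ; 1-homo = refl }

  -- equal integer constants have equal images (the solver only needs this)
  coefficient≟ : ∀ i j → Maybe (⟦ i ⟧ℤ ≈ ⟦ j ⟧ℤ)
  coefficient≟ i j with i ℤ.≟ j
  ... | yes ≡.refl = just refl
  ... | no _ = nothing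

  open import Algebra.Solver.Ring ℤ.+-*-rawRing (fromCommutativeRing R) homomorphism coefficient≟ public

module Counting where

  module _ {a e : Level} {A : Set a} {E : A → A → Set e} where

    count-unique : (∀ {x y} → E x y → E y x) → (∀ {x y z} → E x y → E y z → E x z) →
                   ∀ {p} {Pr : A → Set p} {n m} → Exactly A E Pr n → Exactly A E Pr m → n ≡ m
    count-unique E-sym E-trans (f , fP , fI , fS) (g , gP , gI , gS) =
      FinP.cantor-schröder-bernstein {f = toG} {g = toF} toG-inj toF-inj
      where
      toG = λ i → proj₁ (gS (f i) (fP i))
      toF = λ i → proj₁ (fS (g i) (gP i))
      toG-inj : ∀ {i j} → toG i ≡ toG j → i ≡ j
      toG-inj {i} {j} eq = fI i j (E-trans (proj₂ (gS (f i) (fP i)))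
        (E-sym (≡.subst (λ k → E (f j) (g k)) (≡.sym eq) (proj₂ (gS (f j) (fP j))))))
      toF-inj : ∀ {i j} → toF i ≡ toF j → i ≡ j
      toF-inj {i} {j} eq = gI i j (E-trans (proj₂ (fS (g i) (gP i)))
        (E-sym (≡.subst (λ k → E (g j) (f k)) (≡.sym eq) (proj₂ (fS (g j) (gP j))))))

    transport : ∀ {b e' p p'} {B : Set b} {E' : B → B → Set e'} {Pr' : B → Set p'} {Pr : A → Set p} {n}
      → (∀ {x y z} → E x y → E y z → E x z)
      → Exactly B E' Pr' n → (h : B → A)
      → (∀ x → Pr' x → Pr (h x))
      → (∀ x y → Pr' x → Pr' y → E (h x) (h y) → E' x y)
      → (∀ x y → Pr' x → Pr' y → E' x y → E (h x) (h y))
      → (∀ z → Pr z → Σ B λ x → Pr' x × E z (h x))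
      → Exactly A E Pr n
    transport E-trans (f , fP , fI , fS) h hP hI hR hS =
      h ∘ f , (λ i → hP _ (fP i)) , (λ i j eq → fI i j (hI _ _ (fP i) (fP j) eq)) , surj
      where
      surj : ∀ z → _ → ∃ λ i → E z (h (f i))
      surj z pz with hS z pz
      ... | x , px , ez with fS x px
      ...   | i , ex = i , E-trans ez (hR _ _ px (fP i) ex)

    transport-Fin : ∀ {p p'} {N} {Pr' : Fin N → Set p'} {Pr : A → Set p} {n}
      → (∀ {x} → E x x)
      → (∀ {x y z} → E x y → E y z → E x z)
      → Exactly (Fin N) _≡_ Pr' n → (h : Fin N → A)
      → (∀ x → Pr' x → Pr (h x))
      → (∀ x y → Pr' x → Pr' y → E (h x) (h y) → x ≡ y)
      → (∀ z → Pr z → Σ (Fin N) λ x → Pr' x × E z (h x))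
      → Exactly A E Pr n
    transport-Fin E-refl E-trans ex h hP hI hS =
      transport E-trans ex h hP hI (λ { x .x _ _ ≡.refl → E-refl }) hS

  all-of-Fin : ∀ N → Exactly (Fin N) _≡_ (λ _ → ⊤) N
  all-of-Fin N = id , (λ _ → tt) , (λ i j eq → eq) , (λ z _ → z , ≡.refl)

  module _ {d : Level} where

    count-cons-yes : ∀ {N k} {D : Fin (suc N) → Set d} →
      D fz → Exactly (Fin N) _≡_ (D ∘ fs) k → Exactly (Fin (suc N)) _≡_ D (suc k)
    count-cons-yes {D = D} d0 (f , fP , fI , fS) = g , gP , gI , gS
      where
      g : Fin (suc _) → Fin (suc _)
      g fz = fz
      g (fs j) = fs (f j)
      gP : ∀ i → D (g i)
      gP fz = d0
      gP (fs j) = fP j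
      gI : ∀ i j → g i ≡ g j → i ≡ j
      gI fz fz _ = ≡.refl
      gI fz (fs j) ()
      gI (fs i) fz ()
      gI (fs i) (fs j) eq = ≡.cong fs (fI i j (FinP.suc-injective eq))
      gS : ∀ x → D x → Σ _ λ i → x ≡ g i
      gS fz _ = fz , ≡.refl
      gS (fs x) dx = fs (proj₁ (fS x dx)) , ≡.cong fs (proj₂ (fS x dx))

    count-cons-no : ∀ {N k} {D : Fin (suc N) → Set d} →
      ¬ D fz → Exactly (Fin N) _≡_ (D ∘ fs) k → Exactly (Fin (suc N)) _≡_ D k
    count-cons-no {D = D} ¬d0 (f , fP , fI , fS) = fs ∘ f , fP , (λ i j eq → fI i j (FinP.suc-injective eq)) , gS
      where
      gS : ∀ x → D x → Σ _ λ i → x ≡ fs (f i)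
      gS fz dx = ⊥-elim (¬d0 dx)
      gS (fs x) dx = proj₁ (fS x dx) , ≡.cong fs (proj₂ (fS x dx))

    count-empty : ∀ {D : Fin 0 → Set d} → Exactly (Fin 0) _≡_ D 0
    count-empty = (λ ()) , (λ ()) , (λ ()) , (λ ())

    split-count : ∀ N (D : Fin N → Set d) → (∀ i → Dec (D i)) →
      Σ ℕ λ k → Σ ℕ λ k' → (k ℕ.+ k' ≡ N) × Exactly (Fin N) _≡_ D k × Exactly (Fin N) _≡_ (λ i → ¬ D i) k'
    split-count zero D dec = 0 , 0 , ≡.refl , count-empty , count-empty
    split-count (suc N) D dec with split-count N (D ∘ fs) (dec ∘ fs) | dec fz
    ... | k , k' , eq , ex , ex' | yes d0 =
      suc k , k' , ≡.cong suc eq , count-cons-yes d0 ex , count-cons-no (λ nd → nd d0) ex'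
    ... | k , k' , eq , ex , ex' | no ¬d0 =
      k , suc k' , ≡.trans (ℕP.+-suc k k') (≡.cong suc eq) , count-cons-no ¬d0 ex , count-cons-yes ¬d0 ex'

  complement-count : ∀ {d} N (D : Fin N → Set d) → (∀ i → Dec (D i)) → ∀ {k} →
    Exactly (Fin N) _≡_ D k → Exactly (Fin N) _≡_ (λ i → ¬ D i) (N ∸ k)
  complement-count N D dec {k} ex with split-count N D dec
  ... | k' , k'' , k'+k''≡N , ex' , ex'' = ≡.subst (Exactly (Fin N) _≡_ (λ i → ¬ D i)) k''≡N-k ex''
    where
    k'≡k : k' ≡ k
    k'≡k = count-unique ≡.sym ≡.trans ex' ex
    k''≡N-k : k'' ≡ N ∸ k
    k''≡N-k = ≡.trans (≡.sym (ℕP.m+n∸m≡n k' k'')) (≡.cong₂ _∸_ k'+k''≡N k'≡k)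

  AtMostTwoToOne : ∀ {N M} → (Fin N → Fin M) → Set
  AtMostTwoToOne f = ∀ i j k → f i ≡ f j → f i ≡ f k → i ≡ j ⊎ (i ≡ k ⊎ j ≡ k)

  fibre-≤2 : ∀ {N M} {v : Fin M} k (f : Fin N → Fin M) → AtMostTwoToOne f →
             (g : Fin k → Fin N) → (∀ i → f (g i) ≡ v) → (∀ i j → g i ≡ g j → i ≡ j) → k ≤ 2
  fibre-≤2 0 _ _ _ _ _ = z≤n
  fibre-≤2 1 _ _ _ _ _ = s≤s z≤n
  fibre-≤2 2 _ _ _ _ _ = s≤s (s≤s z≤n)
  fibre-≤2 (suc (suc (suc _))) f two g gv g-inj
    with two (g fz) (g (fs fz)) (g (fs (fs fz)))
             (≡.trans (gv fz) (≡.sym (gv (fs fz)))) (≡.trans (gv fz) (≡.sym (gv (fs (fs fz)))))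
  ... | inj₁ e with () ← g-inj _ _ e
  ... | inj₂ (inj₁ e) with () ← g-inj _ _ e
  ... | inj₂ (inj₂ e) with () ← g-inj _ _ e

  two-to-one-bound : ∀ M N (f : Fin N → Fin M) → AtMostTwoToOne f → N ≤ 2 ℕ.* M
  two-to-one-bound zero zero f _ = z≤n
  two-to-one-bound zero (suc N) f _ with () ← f fz
  two-to-one-bound (suc M) N f two with split-count N (λ i → f i ≡ fz) (λ i → f i FinP.≟ fz)
  ... | k , k' , eq , (g , gP , gI , _) , (g' , g'P , g'I , _) =
    ≡.subst (_≤ 2 ℕ.* suc M) eq (ℕP.≤-trans (ℕP.+-mono-≤ k≤2 k'≤2M) (ℕP.≤-reflexive (≡.sym (ℕP.*-suc 2 M))))
    where
    k≤2 : k ≤ 2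
    k≤2 = fibre-≤2 k f two g gP gI
    -- the elements not over fz, mapped into Fin M by deleting fz
    f' : Fin k' → Fin M
    f' j = punchOut {i = fz} (λ e → g'P j (≡.sym e))
    f'-reflects : ∀ {a b} → f' a ≡ f' b → f (g' a) ≡ f (g' b)
    f'-reflects {a} {b} = FinP.punchOut-injective (λ e → g'P a (≡.sym e)) (λ e → g'P b (≡.sym e))
    k'≤2M : k' ≤ 2 ℕ.* M
    k'≤2M = two-to-one-bound M k' f' λ i j l e₁ e₂ → lift-g' (two (g' i) (g' j) (g' l) (f'-reflects e₁) (f'-reflects e₂))
      where
      lift-g' : ∀ {i j l} → g' i ≡ g' j ⊎ (g' i ≡ g' l ⊎ g' j ≡ g' l) → i ≡ j ⊎ (i ≡ l ⊎ j ≡ l)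
      lift-g' (inj₁ e) = inj₁ (g'I _ _ e)
      lift-g' (inj₂ (inj₁ e)) = inj₂ (inj₁ (g'I _ _ e))
      lift-g' (inj₂ (inj₂ e)) = inj₂ (inj₂ (g'I _ _ e))

  two-to-one-avoiding : ∀ M N (f : Fin N → Fin M) (v : Fin M) → (∀ i → f i ≢ v) → AtMostTwoToOne f → 2 ℕ.+ N ≤ 2 ℕ.* M
  two-to-one-avoiding zero N f () _ _
  two-to-one-avoiding (suc M) N f v avoid two =
    ≡.subst (2 ℕ.+ N ≤_) (≡.sym (ℕP.*-suc 2 M)) (ℕP.+-monoʳ-≤ 2 (two-to-one-bound M N f' two'))
    where
    f' : Fin N → Fin M
    f' i = punchOut {i = v} (λ e → avoid i (≡.sym e))
    two' : AtMostTwoToOne f'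
    two' i j k e₁ e₂ = two i j k
      (FinP.punchOut-injective (λ e → avoid i (≡.sym e)) (λ e → avoid j (≡.sym e)) e₁)
      (FinP.punchOut-injective (λ e → avoid i (≡.sym e)) (λ e → avoid k (≡.sym e)) e₂)

  injective⇒surjective : ∀ n (f : Fin n → Fin n) → (∀ {i j} → f i ≡ f j → i ≡ j) → ∀ v → Σ (Fin n) λ i → f i ≡ v
  injective⇒surjective n f inj v with FinP.any? (λ i → f i FinP.≟ v)
  ... | yes hit = hit
  ... | no miss = ⊥-elim (no-room n f inj v miss)
    where
    no-room : ∀ n (f : Fin n → Fin n) → (∀ {i j} → f i ≡ f j → i ≡ j) → (v : Fin n) → ¬ (Σ (Fin n) λ i → f i ≡ v) → ⊥
    no-room (suc m) f inj v miss = ℕP.<-irrefl ≡.refl (FinP.injective⇒≤ {f = g} g-inj)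
      where
      g : Fin (suc m) → Fin m
      g i = punchOut {i = v} (λ e → miss (i , ≡.sym e))
      g-inj : ∀ {i j} → g i ≡ g j → i ≡ j
      g-inj {i} {j} e = inj (FinP.punchOut-injective (λ e → miss (i , ≡.sym e)) (λ e → miss (j , ≡.sym e)) e)

open Counting

module Field {c ℓ} (R : CommutativeRing c ℓ) (isField : FieldDefs.IsField R)
             (_≟_ : Decidable (CommutativeRing._≈_ R)) where
  open CommutativeRing R public hiding (zero)
  open IntegerSolver R public using (solve; Polynomial; _:+_; _:*_; _:-_; :-_; _:=_; con)
  open import Relation.Binary.Reasoning.Setoid setoid public
  open import Algebra.Properties.Ring ring public using (-‿involutive; -‿distribˡ-*; -‿distribʳ-*; -0#≈0#)

  :0 :1 :2 : ∀ {n} → Polynomial n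
  :0 = con (+ 0)
  :1 = con (+ 1)
  :2 = con (+ 2)

  1≉0 : 1# ≉ 0#
  1≉0 = proj₁ isField

  inv : ∀ x → x ≉ 0# → Carrier
  inv x x≉0 = proj₁ (proj₂ isField x x≉0)

  inv-r : ∀ x (x≉0 : x ≉ 0#) → x * inv x x≉0 ≈ 1#
  inv-r x x≉0 = proj₂ (proj₂ isField x x≉0)

  inv-l : ∀ x (x≉0 : x ≉ 0#) → inv x x≉0 * x ≈ 1#
  inv-l x x≉0 = trans (*-comm _ _) (inv-r x x≉0)

  expand-invˡ : ∀ x (x≉0 : x ≉ 0#) y → y ≈ inv x x≉0 * (x * y)
  expand-invˡ x x≉0 y = sym (begin
    inv x x≉0 * (x * y)  ≈⟨ sym (*-assoc _ _ _) ⟩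
    (inv x x≉0 * x) * y  ≈⟨ *-congʳ (inv-l x x≉0) ⟩
    1# * y               ≈⟨ *-identityˡ y ⟩
    y                    ∎)

  expand-invʳ : ∀ x (x≉0 : x ≉ 0#) y → y ≈ x * (inv x x≉0 * y)
  expand-invʳ x x≉0 y = sym (begin
    x * (inv x x≉0 * y)  ≈⟨ sym (*-assoc _ _ _) ⟩
    (x * inv x x≉0) * y  ≈⟨ *-congʳ (inv-r x x≉0) ⟩
    1# * y               ≈⟨ *-identityˡ y ⟩
    y                    ∎)

  cancelˡ : ∀ x → x ≉ 0# → ∀ {y z} → x * y ≈ x * z → y ≈ z
  cancelˡ x x≉0 {y} {z} e = trans (expand-invˡ x x≉0 y) (trans (*-congˡ e) (sym (expand-invˡ x x≉0 z)))

  cancel-0 : ∀ x → x ≉ 0# → ∀ {y} → x * y ≈ 0# → y ≈ 0#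
  cancel-0 x x≉0 e = cancelˡ x x≉0 (trans e (sym (zeroʳ x)))

  *-≉0 : ∀ {x y} → x ≉ 0# → y ≉ 0# → x * y ≉ 0#
  *-≉0 {x} x≉0 y≉0 e = y≉0 (cancel-0 x x≉0 e)

  sq-≉0 : ∀ {x} → x ≉ 0# → x * x ≉ 0#
  sq-≉0 x≉0 = *-≉0 x≉0 x≉0

  inv-≉0 : ∀ x (x≉0 : x ≉ 0#) → inv x x≉0 ≉ 0#
  inv-≉0 x x≉0 e = 1≉0 (trans (sym (inv-r x x≉0)) (trans (*-congˡ e) (zeroʳ x)))

  -‿≉0 : ∀ {x} → x ≉ 0# → - x ≉ 0#
  -‿≉0 {x} x≉0 e = x≉0 (trans (sym (-‿involutive x)) (trans (-‿cong e) -0#≈0#))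

  *≈0 : ∀ {x y} → x * y ≈ 0# → x ≈ 0# ⊎ y ≈ 0#
  *≈0 {x} e with x ≟ 0#
  ... | yes x≈0 = inj₁ x≈0
  ... | no x≉0 = inj₂ (cancel-0 x x≉0 e)

  sq≈0 : ∀ {u} → u * u ≈ 0# → u ≈ 0#
  sq≈0 e = [ id , id ] (*≈0 e)

  x*0≈0 : ∀ {x y} → y ≈ 0# → x * y ≈ 0#
  x*0≈0 {x} e = trans (*-congˡ e) (zeroʳ x)

  0*x≈0 : ∀ {x y} → x ≈ 0# → x * y ≈ 0#
  0*x≈0 {y = y} e = trans (*-congʳ e) (zeroˡ y)

  x-y≈0⇒x≈y : ∀ {x y} → x - y ≈ 0# → x ≈ y
  x-y≈0⇒x≈y {x} {y} e = begin
    x              ≈⟨ sym (+-identityʳ x) ⟩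
    x + 0#         ≈⟨ +-congˡ (sym (-‿inverseˡ y)) ⟩
    x + (- y + y)  ≈⟨ sym (+-assoc _ _ _) ⟩
    (x - y) + y    ≈⟨ +-congʳ e ⟩
    0# + y         ≈⟨ +-identityˡ y ⟩
    y              ∎

  x≈y⇒x-y≈0 : ∀ {x y} → x ≈ y → x - y ≈ 0#
  x≈y⇒x-y≈0 {x} {y} e = trans (+-congʳ e) (-‿inverseʳ y)

  x+y≈0⇒y≈-x : ∀ {x y} → x + y ≈ 0# → y ≈ - x
  x+y≈0⇒y≈-x {x} {y} e = begin
    y              ≈⟨ sym (+-identityˡ y) ⟩
    0# + y         ≈⟨ +-congʳ (sym (-‿inverseˡ x)) ⟩
    (- x + x) + y  ≈⟨ +-assoc _ _ _ ⟩
    - x + (x + y)  ≈⟨ +-congˡ e ⟩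
    - x + 0#       ≈⟨ +-identityʳ _ ⟩
    - x            ∎

  x+y≈0⇒x≈-y : ∀ {x y} → x + y ≈ 0# → x ≈ - y
  x+y≈0⇒x≈-y e = x+y≈0⇒y≈-x (trans (+-comm _ _) e)

  -‿injective : ∀ {y z} → - y ≈ - z → y ≈ z
  -‿injective {y} {z} e = trans (sym (-‿involutive y)) (trans (-‿cong e) (-‿involutive z))

  -‿≈0 : ∀ {x} → x ≈ 0# → - x ≈ 0#
  -‿≈0 e = trans (-‿cong e) -0#≈0#

  combination-0 : ∀ {a b u v} → u ≈ 0# → v ≈ 0# → a * u - b * v ≈ 0#
  combination-0 u≈0 v≈0 = trans (+-cong (x*0≈0 u≈0) (-‿≈0 (x*0≈0 v≈0))) (+-identityʳ 0#)

  +-cancelˡ : ∀ a {b b'} → a + b ≈ a + b' → b ≈ b'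
  +-cancelˡ a {b} {b'} e = trans (sym (strip b)) (trans (+-congˡ e) (strip b'))
    where
    strip : ∀ y → - a + (a + y) ≈ y
    strip y = trans (sym (+-assoc _ _ _)) (trans (+-congʳ (-‿inverseˡ a)) (+-identityˡ y))

  sq-eq : ∀ {x y} → x * x ≈ y * y → y ≈ x ⊎ y ≈ - x
  sq-eq {x} {y} e with *≈0 {y - x} {y + x} (trans (difference-of-squares x y) (x≈y⇒x-y≈0 (sym e)))
    where
    difference-of-squares : ∀ x y → (y - x) * (y + x) ≈ y * y - x * x
    difference-of-squares = solve 2 (λ x y → (y :- x) :* (y :+ x) := y :* y :- x :* x) refl
  ... | inj₁ e' = inj₁ (x-y≈0⇒x≈y e')
  ... | inj₂ e' = inj₂ (x-y≈0⇒x≈y (trans (+-congˡ (-‿involutive x)) e'))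

  V3 : Set c
  V3 = Fin 3 → Carrier

  pattern 0F = fz
  pattern 1F = fs fz
  pattern 2F = fs (fs fz)

  v3 : Carrier → Carrier → Carrier → V3
  v3 a b d 0F = a
  v3 a b d 1F = b
  v3 a b d 2F = d

  NonZero3 : V3 → Set ℓ
  NonZero3 x = ¬ (x 0F ≈ 0# × x 1F ≈ 0# × x 2F ≈ 0#)

  nonzero-coordinate : ∀ {x : V3} → NonZero3 x → Σ (Fin 3) λ k → x k ≉ 0#
  nonzero-coordinate {x} x≠0 with x 0F ≟ 0# | x 1F ≟ 0# | x 2F ≟ 0#
  ... | no a  | _     | _     = 0F , a
  ... | yes _ | no a  | _     = 1F , a
  ... | yes _ | yes _ | no a  = 2F , a
  ... | yes a | yes b | yes d = ⊥-elim (x≠0 (a , b , d))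

  Prop3 : V3 → V3 → Set (c ⊔ ℓ)
  Prop3 x y = Σ Carrier λ t → (t ≉ 0#) × (∀ i → y i ≈ t * x i)

  Prop3-refl : ∀ {x} → Prop3 x x
  Prop3-refl = 1# , 1≉0 , λ i → sym (*-identityˡ _)

  Prop3-trans : ∀ {x y z} → Prop3 x y → Prop3 y z → Prop3 x z
  Prop3-trans (s , s≉0 , y≈sx) (t , t≉0 , z≈ty) =
    t * s , *-≉0 t≉0 s≉0 , λ i → trans (z≈ty i) (trans (*-congˡ (y≈sx i)) (sym (*-assoc _ _ _)))

  Prop3-sym : ∀ {x y} → Prop3 x y → Prop3 y x
  Prop3-sym {x} (t , t≉0 , y≈tx) =
    inv t t≉0 , inv-≉0 t t≉0 , λ i → trans (expand-invˡ t t≉0 (x i)) (*-congˡ (sym (y≈tx i)))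

  NonZero2 : Carrier × Carrier → Set ℓ
  NonZero2 (y₁ , y₂) = ¬ (y₁ ≈ 0# × y₂ ≈ 0#)

  Prop2 : Carrier × Carrier → Carrier × Carrier → Set (c ⊔ ℓ)
  Prop2 (x₁ , x₂) (y₁ , y₂) = Σ Carrier λ t → (t ≉ 0#) × (y₁ ≈ t * x₁) × (y₂ ≈ t * x₂)

  det2≈0⇒Prop2 : ∀ {y₁ y₂ z₁ z₂} → NonZero2 (y₁ , y₂) → NonZero2 (z₁ , z₂) → y₁ * z₂ ≈ y₂ * z₁ → Prop2 (y₁ , y₂) (z₁ , z₂)
  det2≈0⇒Prop2 {y₁} {y₂} {z₁} {z₂} y≠0 z≠0 det≈0 with y₁ ≟ 0#
  ... | no y₁≉0 = t , t≉0 , z₁≈ty₁ , z₂≈ty₂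
    where
    t = inv y₁ y₁≉0 * z₁
    z₁≈ty₁ : z₁ ≈ t * y₁
    z₁≈ty₁ = sym (trans (*-congʳ (*-comm _ _)) (trans (*-assoc _ _ _) (trans (*-congˡ (inv-l y₁ y₁≉0)) (*-identityʳ z₁))))
    z₂≈ty₂ : z₂ ≈ t * y₂
    z₂≈ty₂ = cancelˡ y₁ y₁≉0 (trans det≈0 (trans (*-comm _ _) (trans (expand-invʳ y₁ y₁≉0 (z₁ * y₂)) (*-congˡ (sym (*-assoc _ _ _))))))
    t≉0 : t ≉ 0#
    t≉0 t≈0 = z≠0 (z₁≈0 , cancel-0 y₁ y₁≉0 (trans det≈0 (x*0≈0 z₁≈0)))
      where
      z₁≈0 : z₁ ≈ 0#
      z₁≈0 = trans (expand-invʳ y₁ y₁≉0 z₁) (x*0≈0 t≈0)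
  ... | yes y₁≈0 with y₂ ≟ 0#
  ...   | yes y₂≈0 = ⊥-elim (y≠0 (y₁≈0 , y₂≈0))
  ...   | no y₂≉0 = t , t≉0 , trans z₁≈0 (sym (x*0≈0 y₁≈0)) , z₂≈ty₂
    where
    t = inv y₂ y₂≉0 * z₂
    z₁≈0 : z₁ ≈ 0#
    z₁≈0 = cancel-0 y₂ y₂≉0 (trans (sym det≈0) (0*x≈0 y₁≈0))
    z₂≈ty₂ : z₂ ≈ t * y₂
    z₂≈ty₂ = sym (trans (*-congʳ (*-comm _ _)) (trans (*-assoc _ _ _) (trans (*-congˡ (inv-l y₂ y₂≉0)) (*-identityʳ z₂))))
    t≉0 : t ≉ 0#
    t≉0 t≈0 = z≠0 (z₁≈0 , trans (expand-invʳ y₂ y₂≉0 z₂) (x*0≈0 t≈0))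

module FiniteField {c ℓ} (R : CommutativeRing c ℓ) (q : ℕ) (ff : FieldDefs.IsFiniteField R q) where
  open Field R (proj₁ ff) (proj₂ (proj₂ ff)) public


  infix 4 _≟_
  _≟_ : Decidable _≈_
  _≟_ = proj₂ (proj₂ ff)

  elem : Fin q → Carrier
  elem = proj₁ (proj₁ (proj₂ ff))

  elem-inj : ∀ i j → elem i ≈ elem j → i ≡ j
  elem-inj = proj₁ (proj₂ (proj₂ (proj₁ (proj₂ ff))))

  index : Carrier → Fin q
  index x = proj₁ (proj₂ (proj₂ (proj₂ (proj₁ (proj₂ ff)))) x (lift tt))

  index-≈ : ∀ x → x ≈ elem (index x)
  index-≈ x = proj₂ (proj₂ (proj₂ (proj₂ (proj₁ (proj₂ ff)))) x (lift tt))

  splitAt-inj : ∀ m n {i j : Fin (m ℕ.+ n)} → splitAt m i ≡ splitAt m j → i ≡ j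
  splitAt-inj m n {i} {j} eq =
    ≡.trans (≡.sym (FinP.join-splitAt m n i)) (≡.trans (≡.cong (join m n) eq) (FinP.join-splitAt m n j))

  point1′ : Fin q ⊎ Fin 1 → Carrier × Carrier
  point1′ (inj₁ j) = 1# , elem j
  point1′ (inj₂ _) = 0# , 1#

  point1 : Fin (q ℕ.+ 1) → Carrier × Carrier
  point1 i = point1′ (splitAt q i)

  point1′-inj : ∀ u v → Prop2 (point1′ u) (point1′ v) → u ≡ v
  point1′-inj (inj₁ a) (inj₁ b) (t , _ , e₁ , e₂) = ≡.cong inj₁ (elem-inj a b (sym (trans e₂ (trans (*-congʳ t≈1) (*-identityˡ _)))))
    where
    t≈1 : t ≈ 1#
    t≈1 = sym (trans e₁ (*-identityʳ t))
  point1′-inj (inj₁ a) (inj₂ _) (t , t≉0 , e₁ , _) = ⊥-elim (t≉0 (sym (trans e₁ (*-identityʳ t))))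
  point1′-inj (inj₂ _) (inj₁ b) (t , _ , e₁ , _) = ⊥-elim (1≉0 (trans e₁ (zeroʳ t)))
  point1′-inj (inj₂ fz) (inj₂ fz) _ = ≡.refl

  point1-inj : ∀ i j → Prop2 (point1 i) (point1 j) → i ≡ j
  point1-inj i j pr = splitAt-inj q 1 (point1′-inj _ _ pr)

  point1-nonzero : ∀ i → NonZero2 (point1 i)
  point1-nonzero i with splitAt q i
  ... | inj₁ _ = λ z → 1≉0 (proj₁ z)
  ... | inj₂ _ = λ z → 1≉0 (proj₂ z)

  point1′-surj : ∀ w₁ w₂ → NonZero2 (w₁ , w₂) → Σ _ λ u → Prop2 (point1′ u) (w₁ , w₂)
  point1′-surj w₁ w₂ w≠0 with w₁ ≟ 0#
  ... | no w₁≉0 = inj₁ (index s) , w₁ , w₁≉0 , sym (*-identityʳ w₁) , sym (begin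
          w₁ * elem (index s)    ≈⟨ *-congˡ (sym (index-≈ s)) ⟩
          w₁ * (w₂ * inv w₁ w₁≉0)  ≈⟨ *-congˡ (*-comm _ _) ⟩
          w₁ * (inv w₁ w₁≉0 * w₂)  ≈⟨ sym (expand-invʳ w₁ w₁≉0 w₂) ⟩
          w₂                     ∎)
    where s = w₂ * inv w₁ w₁≉0
  ... | yes w₁≈0 with w₂ ≟ 0#
  ...   | yes w₂≈0 = ⊥-elim (w≠0 (w₁≈0 , w₂≈0))
  ...   | no w₂≉0 = inj₂ fz , w₂ , w₂≉0 , trans w₁≈0 (sym (zeroʳ w₂)) , sym (*-identityʳ w₂)

  point1-surj : ∀ w₁ w₂ → NonZero2 (w₁ , w₂) → Σ _ λ i → Prop2 (point1 i) (w₁ , w₂)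
  point1-surj w₁ w₂ w≠0 with point1′-surj w₁ w₂ w≠0
  ... | u , pr = join q 1 u , ≡.subst (λ p → Prop2 p (w₁ , w₂)) (≡.sym (≡.cong point1′ (FinP.splitAt-join q 1 u))) pr

  N2 : ℕ
  N2 = q ℕ.* q ℕ.+ (q ℕ.+ 1)

  point2′ : Fin (q ℕ.* q) ⊎ Fin (q ℕ.+ 1) → V3
  point2′ (inj₁ k) = v3 1# (elem (proj₁ (remQuot {q} q k))) (elem (proj₂ (remQuot {q} q k)))
  point2′ (inj₂ m) = v3 0# (proj₁ (point1 m)) (proj₂ (point1 m))

  point2 : Fin N2 → V3
  point2 i = point2′ (splitAt (q ℕ.* q) i)

  remQuot-inj : ∀ {k k' : Fin (q ℕ.* q)} → remQuot {q} q k ≡ remQuot q k' → k ≡ k'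
  remQuot-inj {k} {k'} eq =
    ≡.trans (≡.sym (FinP.combine-remQuot {q} q k)) (≡.trans (≡.cong (uncurry (combine {q} {q})) eq) (FinP.combine-remQuot {q} q k'))

  ×-≡ : ∀ {A B : Set} {a a' : A} {b b' : B} → a ≡ a' → b ≡ b' → (a , b) ≡ (a' , b')
  ×-≡ ≡.refl ≡.refl = ≡.refl

  point2′-inj : ∀ u v → Prop3 (point2′ u) (point2′ v) → u ≡ v
  point2′-inj (inj₁ k) (inj₁ k') (t , _ , h) = ≡.cong inj₁ (remQuot-inj (×-≡
      (elem-inj _ _ (sym (trans (h 1F) (trans (*-congʳ t≈1) (*-identityˡ _)))))
      (elem-inj _ _ (sym (trans (h 2F) (trans (*-congʳ t≈1) (*-identityˡ _)))))))
    where
    t≈1 : t ≈ 1#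
    t≈1 = sym (trans (h 0F) (*-identityʳ t))
  point2′-inj (inj₁ k) (inj₂ m) (t , t≉0 , h) = ⊥-elim (t≉0 (sym (trans (h 0F) (*-identityʳ t))))
  point2′-inj (inj₂ m) (inj₁ k) (t , _ , h) = ⊥-elim (1≉0 (trans (h 0F) (zeroʳ t)))
  point2′-inj (inj₂ m) (inj₂ m') (t , t≉0 , h) = ≡.cong inj₂ (point1-inj m m' (t , t≉0 , h 1F , h 2F))

  point2-inj : ∀ i j → Prop3 (point2 i) (point2 j) → i ≡ j
  point2-inj i j pr = splitAt-inj (q ℕ.* q) (q ℕ.+ 1) (point2′-inj _ _ pr)

  point2-nonzero : ∀ i → NonZero3 (point2 i)
  point2-nonzero i with splitAt (q ℕ.* q) i
  ... | inj₁ _ = λ z → 1≉0 (proj₁ z)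
  ... | inj₂ m = λ z → point1-nonzero m (proj₂ z)

  point2′-surj : ∀ x → NonZero3 x → Σ _ λ u → Prop3 (point2′ u) x
  point2′-surj x x≠0 with x 0F ≟ 0#
  ... | no x₀≉0 = inj₁ k , x 0F , x₀≉0 , coords
    where
    a = x 1F * inv (x 0F) x₀≉0
    b = x 2F * inv (x 0F) x₀≉0
    k = combine {q} {q} (index a) (index b)
    rq : remQuot {q} q k ≡ (index a , index b)
    rq = FinP.remQuot-combine {q} {q} (index a) (index b)
    expand : ∀ y → y ≈ x 0F * (y * inv (x 0F) x₀≉0)
    expand y = trans (expand-invʳ (x 0F) x₀≉0 y) (*-congˡ (*-comm _ _))
    coords : ∀ i → x i ≈ x 0F * point2′ (inj₁ k) i
    coords 0F = sym (*-identityʳ _)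
    coords 1F = trans (expand (x 1F)) (*-congˡ (trans (index-≈ a) (reflexive (≡.cong (λ p → elem (proj₁ p)) (≡.sym rq)))))
    coords 2F = trans (expand (x 2F)) (*-congˡ (trans (index-≈ b) (reflexive (≡.cong (λ p → elem (proj₂ p)) (≡.sym rq)))))
  ... | yes x₀≈0 with point1-surj (x 1F) (x 2F) (λ { (x₁≈0 , x₂≈0) → x≠0 (x₀≈0 , x₁≈0 , x₂≈0) })
  ...   | m , t , t≉0 , h₁ , h₂ = inj₂ m , t , t≉0 , coords
    where
    coords : ∀ i → x i ≈ t * point2′ (inj₂ m) i
    coords 0F = trans x₀≈0 (sym (zeroʳ t))
    coords 1F = h₁
    coords 2F = h₂

  point2-surj : ∀ x → NonZero3 x → Σ (Fin N2) λ i → Prop3 (point2 i) x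
  point2-surj x x≠0 with point2′-surj x x≠0
  ... | u , pr = join (q ℕ.* q) (q ℕ.+ 1) u ,
                 ≡.subst (λ p → Prop3 p x) (≡.sym (≡.cong point2′ (FinP.splitAt-join (q ℕ.* q) (q ℕ.+ 1) u))) pr

  -- For α, β ≠ 0 the equation α u² = γ − β w² has a solution.  Otherwise
  -- consider on Fin q ⊎ Fin q the values  α u²  and  γ − β w²  (the latter
  -- replaced by 0 when w = 0).  They avoid γ and every value is attained at
  -- most twice (by ±u, ±w, or by u = 0 and w = 0), so 2q + 2 ≤ 2q.
  module _ (α β γ : Carrier) (α≉0 : α ≉ 0#) (β≉0 : β ≉ 0#)
           (no-solution : ∀ j₁ j₂ → ¬ (α * (elem j₁ * elem j₁) ≈ γ - β * (elem j₂ * elem j₂))) where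

    j₀ : Fin q
    j₀ = index 0#

    elem-j₀ : elem j₀ ≈ 0#
    elem-j₀ = sym (index-≈ 0#)

    is-j₀ : ∀ {j} → elem j ≈ 0# → j ≡ j₀
    is-j₀ e = elem-inj _ _ (trans e (sym elem-j₀))

    γ-β0 : ∀ {w} → w ≈ 0# → γ - β * (w * w) ≈ γ
    γ-β0 w≈0 = trans (+-congˡ (trans (-‿cong (x*0≈0 (0*x≈0 w≈0))) -0#≈0#)) (+-identityʳ γ)

    value : Fin q ⊎ Fin q → Carrier
    value (inj₁ j) = α * (elem j * elem j)
    value (inj₂ j) with elem j ≟ 0#
    ... | yes _ = 0#
    ... | no _ = γ - β * (elem j * elem j)

    γ≉0 : γ ≉ 0#
    γ≉0 γ≈0 = no-solution j₀ j₀ (trans (x*0≈0 (0*x≈0 elem-j₀)) (trans (sym γ≈0) (sym (γ-β0 elem-j₀))))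

    γ-y≈γ : ∀ {y} → γ - y ≈ γ → y ≈ 0#
    γ-y≈γ e = -‿injective (trans (+-cancelˡ γ (trans e (sym (+-identityʳ γ)))) (sym -0#≈0#))

    value≉γ : ∀ x → value x ≉ γ
    value≉γ (inj₁ j) e = no-solution j j₀ (trans e (sym (γ-β0 elem-j₀)))
    value≉γ (inj₂ j) e with elem j ≟ 0#
    ... | yes _ = γ≉0 (sym e)
    ... | no ej≉0 = sq-≉0 ej≉0 (cancel-0 β β≉0 (γ-y≈γ e))

    -- the second element with the same value
    Opposite : Fin q ⊎ Fin q → Fin q ⊎ Fin q → Set ℓ
    Opposite (inj₁ a) (inj₁ b) = elem b ≈ - elem a
    Opposite (inj₂ a) (inj₂ b) = elem b ≈ - elem a
    Opposite (inj₁ a) (inj₂ b) = elem a ≈ 0# × elem b ≈ 0#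
    Opposite (inj₂ a) (inj₁ b) = elem a ≈ 0# × elem b ≈ 0#

    equal-squares : ∀ {a b} → elem a * elem a ≈ elem b * elem b → a ≡ b ⊎ elem b ≈ - elem a
    equal-squares e with sq-eq e
    ... | inj₁ e' = inj₁ (elem-inj _ _ (sym e'))
    ... | inj₂ e' = inj₂ e'

    same-value : ∀ x y → value x ≈ value y → x ≡ y ⊎ Opposite x y
    same-value (inj₁ a) (inj₁ b) e = map₁ (≡.cong inj₁) (equal-squares (cancelˡ α α≉0 e))
    same-value (inj₁ a) (inj₂ b) e with elem b ≟ 0#
    ... | yes b≈0 = inj₂ (sq≈0 (cancel-0 α α≉0 e) , b≈0)
    ... | no _ = ⊥-elim (no-solution a b e)
    same-value (inj₂ a) (inj₁ b) e with elem a ≟ 0#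
    ... | yes a≈0 = inj₂ (a≈0 , sq≈0 (cancel-0 α α≉0 (sym e)))
    ... | no _ = ⊥-elim (no-solution b a (sym e))
    same-value (inj₂ a) (inj₂ b) e with elem a ≟ 0# | elem b ≟ 0#
    ... | yes a≈0 | yes b≈0 = inj₁ (≡.cong inj₂ (≡.trans (is-j₀ a≈0) (≡.sym (is-j₀ b≈0))))
    ... | yes _   | no _    = ⊥-elim (no-solution j₀ b (trans (x*0≈0 (0*x≈0 elem-j₀)) e))
    ... | no _    | yes _   = ⊥-elim (no-solution j₀ a (trans (x*0≈0 (0*x≈0 elem-j₀)) (sym e)))
    ... | no _    | no _    = map₁ (≡.cong inj₂) (equal-squares (cancelˡ β β≉0 (-‿injective (+-cancelˡ γ e))))

    opposite-twice : ∀ x y z → Opposite x y → Opposite x z → x ≡ y ⊎ (x ≡ z ⊎ y ≡ z)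
    opposite-twice (inj₁ a) (inj₁ b) (inj₁ d) y≈-x z≈-x = inj₂ (inj₂ (≡.cong inj₁ (elem-inj _ _ (trans y≈-x (sym z≈-x)))))
    opposite-twice (inj₂ a) (inj₂ b) (inj₂ d) y≈-x z≈-x = inj₂ (inj₂ (≡.cong inj₂ (elem-inj _ _ (trans y≈-x (sym z≈-x)))))
    opposite-twice (inj₁ a) (inj₂ b) (inj₂ d) (_ , b≈0) (_ , d≈0) = inj₂ (inj₂ (≡.cong inj₂ (elem-inj _ _ (trans b≈0 (sym d≈0)))))
    opposite-twice (inj₂ a) (inj₁ b) (inj₁ d) (_ , b≈0) (_ , d≈0) = inj₂ (inj₂ (≡.cong inj₁ (elem-inj _ _ (trans b≈0 (sym d≈0)))))
    opposite-twice (inj₁ a) (inj₁ b) (inj₂ d) y≈-x (a≈0 , _) = inj₁ (≡.cong inj₁ (elem-inj _ _ (trans a≈0 (sym (trans y≈-x (-‿≈0 a≈0))))))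
    opposite-twice (inj₂ a) (inj₂ b) (inj₁ d) y≈-x (a≈0 , _) = inj₁ (≡.cong inj₂ (elem-inj _ _ (trans a≈0 (sym (trans y≈-x (-‿≈0 a≈0))))))
    opposite-twice (inj₁ a) (inj₂ b) (inj₁ d) (a≈0 , _) z≈-x = inj₂ (inj₁ (≡.cong inj₁ (elem-inj _ _ (trans a≈0 (sym (trans z≈-x (-‿≈0 a≈0)))))))
    opposite-twice (inj₂ a) (inj₁ b) (inj₂ d) (a≈0 , _) z≈-x = inj₂ (inj₁ (≡.cong inj₂ (elem-inj _ _ (trans a≈0 (sym (trans z≈-x (-‿≈0 a≈0)))))))

    value-index : Fin (q ℕ.+ q) → Fin q
    value-index i = index (value (splitAt q i))

    value-index-≈ : ∀ i j → value-index i ≡ value-index j → value (splitAt q i) ≈ value (splitAt q j)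
    value-index-≈ i j eq = trans (index-≈ _) (trans (reflexive (≡.cong elem eq)) (sym (index-≈ _)))

    value-two-to-one : AtMostTwoToOne value-index
    value-two-to-one i j k e₁ e₂ with same-value _ _ (value-index-≈ i j e₁) | same-value _ _ (value-index-≈ i k e₂)
    ... | inj₁ p | _ = inj₁ (splitAt-inj q q p)
    ... | inj₂ _ | inj₁ p = inj₂ (inj₁ (splitAt-inj q q p))
    ... | inj₂ o₁ | inj₂ o₂ = map (splitAt-inj q q) (map (splitAt-inj q q) (splitAt-inj q q)) (opposite-twice _ _ _ o₁ o₂)

    value-avoids-γ : ∀ i → value-index i ≢ index γ
    value-avoids-γ i eq = value≉γ (splitAt q i) (trans (index-≈ _) (trans (reflexive (≡.cong elem eq)) (sym (index-≈ γ))))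

    contradiction : ⊥
    contradiction = ℕP.<-irrefl ≡.refl (ℕP.≤-trans (ℕP.n≤1+n _) (ℕP.≤-trans bound (ℕP.≤-reflexive (≡.cong (q ℕ.+_) (ℕP.+-identityʳ q)))))
      where
      bound : 2 ℕ.+ (q ℕ.+ q) ≤ 2 ℕ.* q
      bound = two-to-one-avoiding q (q ℕ.+ q) value-index (index γ) value-avoids-γ value-two-to-one

  two-squares : ∀ α β γ → α ≉ 0# → β ≉ 0# → Σ Carrier λ u → Σ Carrier λ w → α * (u * u) ≈ γ - β * (w * w)
  two-squares α β γ α≉0 β≉0 with FinP.any? (λ j₁ → FinP.any? (λ j₂ → α * (elem j₁ * elem j₁) ≟ γ - β * (elem j₂ * elem j₂)))
  ... | yes (j₁ , j₂ , e) = elem j₁ , elem j₂ , e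
  ... | no none = ⊥-elim (contradiction α β γ α≉0 β≉0 (λ j₁ j₂ e → none (j₁ , j₂ , e)))

  -- In characteristic 2 squaring is injective, hence bijective on the finite F.
  module Characteristic2 (2≈0 : 1# + 1# ≈ 0#) where

    -‿self : ∀ u → - u ≈ u
    -‿self u = sym (x+y≈0⇒x≈-y (trans (double u) (0*x≈0 2≈0)))
      where
      double : ∀ u → u + u ≈ (1# + 1#) * u
      double = solve 1 (λ u → u :+ u := :2 :* u) refl

    sq-injective : ∀ {u w} → u * u ≈ w * w → u ≈ w
    sq-injective e = [ sym , (λ w≈-u → sym (trans w≈-u (-‿self _))) ] (sq-eq e)

    square-index : Fin q → Fin q
    square-index j = index (elem j * elem j)

    square-index-inj : ∀ {i j} → square-index i ≡ square-index j → i ≡ j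
    square-index-inj eq = elem-inj _ _ (sq-injective (trans (index-≈ _) (trans (reflexive (≡.cong elem eq)) (sym (index-≈ _)))))

    sqrt : Carrier → Carrier
    sqrt v = elem (proj₁ (injective⇒surjective q square-index square-index-inj (index v)))

    sqrt-sq : ∀ v → sqrt v * sqrt v ≈ v
    sqrt-sq v = trans (index-≈ _)
      (trans (reflexive (≡.cong elem (proj₂ (injective⇒surjective q square-index square-index-inj (index v))))) (sym (index-≈ v)))

-- Polynomial expressions for the symmetric bilinear form xᵀ A y, the
-- quadratic form xᵀ A x and 3×3 determinants, written over an arbitrary
-- "add, mul, sub" so that the same expressions serve both as ring elements
-- and as input to the ring solver.
module Template {x : Level} {X : Set x} (add mul sub : X → X → X) where
  -- A is the symmetric matrix with upper triangle a00 a01 a02 a11 a12 a22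
  Bilin : (a00 a01 a02 a11 a12 a22 x0 x1 x2 y0 y1 y2 : X) → X
  Bilin a00 a01 a02 a11 a12 a22 x0 x1 x2 y0 y1 y2 =
    add (add (mul x0 (add (add (mul a00 y0) (mul a01 y1)) (mul a02 y2)))
             (mul x1 (add (add (mul a01 y0) (mul a11 y1)) (mul a12 y2))))
        (mul x2 (add (add (mul a02 y0) (mul a12 y1)) (mul a22 y2)))

  Quad : (a00 a01 a02 a11 a12 a22 x0 x1 x2 : X) → X
  Quad a00 a01 a02 a11 a12 a22 x0 x1 x2 = Bilin a00 a01 a02 a11 a12 a22 x0 x1 x2 x0 x1 x2

  -- determinant of a 3×3 matrix, literally the expansion used in Defs.det3
  Det : (m00 m01 m02 m10 m11 m12 m20 m21 m22 : X) → X
  Det m00 m01 m02 m10 m11 m12 m20 m21 m22 =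
    add (sub (mul m00 (sub (mul m11 m22) (mul m12 m21)))
             (mul m01 (sub (mul m10 m22) (mul m12 m20))))
        (mul m02 (sub (mul m10 m21) (mul m11 m20)))

  SymDet : (a00 a01 a02 a11 a12 a22 : X) → X
  SymDet a00 a01 a02 a11 a12 a22 = Det a00 a01 a02 a01 a11 a12 a02 a12 a22

-- In odd
-- characteristic A has an isotropic vector p (by two-squares), and the
-- lines through p in the plane meet the conic in one further point each,
-- giving a bijection with PG(1,q).  In characteristic 2 the quadratic form
-- is a00 x0² + a11 x1² + a22 x2², whose zero set is a line since squaring
-- is bijective on F.
module Conic {c ℓ} (R : CommutativeRing c ℓ) (q : ℕ) (ff : FieldDefs.IsFiniteField R q) where
  open FiniteField R q ff public
  open Template
  B₀ = Bilin _+_ _*_ _-_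
  Q₀ = Quad _+_ _*_ _-_
  D₀ = SymDet _+_ _*_ _-_
  Det₀ = Det _+_ _*_ _-_

  :Bilin : ∀ {n} → (a00 a01 a02 a11 a12 a22 x0 x1 x2 y0 y1 y2 : Polynomial n) → Polynomial n
  :Bilin = Bilin _:+_ _:*_ _:-_

  :Quad : ∀ {n} → (a00 a01 a02 a11 a12 a22 x0 x1 x2 : Polynomial n) → Polynomial n
  :Quad = Quad _:+_ _:*_ _:-_

  :SymDet : ∀ {n} → (a00 a01 a02 a11 a12 a22 : Polynomial n) → Polynomial n
  :SymDet = SymDet _:+_ _:*_ _:-_

  :Det : ∀ {n} → (m00 m01 m02 m10 m11 m12 m20 m21 m22 : Polynomial n) → Polynomial n
  :Det = Det _:+_ _:*_ _:-_

  B₀-cong : ∀ {a00 a01 a02 a11 a12 a22 x0 x1 x2 y0 y1 y2 x0' x1' x2' y0' y1' y2'} →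
    x0 ≈ x0' → x1 ≈ x1' → x2 ≈ x2' → y0 ≈ y0' → y1 ≈ y1' → y2 ≈ y2' →
    B₀ a00 a01 a02 a11 a12 a22 x0 x1 x2 y0 y1 y2 ≈ B₀ a00 a01 a02 a11 a12 a22 x0' x1' x2' y0' y1' y2'
  B₀-cong e0 e1 e2 f0 f1 f2 =
    +-cong (+-cong (*-cong e0 (+-cong (+-cong (*-congˡ f0) (*-congˡ f1)) (*-congˡ f2)))
                   (*-cong e1 (+-cong (+-cong (*-congˡ f0) (*-congˡ f1)) (*-congˡ f2))))
           (*-cong e2 (+-cong (+-cong (*-congˡ f0) (*-congˡ f1)) (*-congˡ f2)))

  Det₀-cong : ∀ {m00 m01 m02 m10 m11 m12 m20 m21 m22 n00 n01 n02 n10 n11 n12 n20 n21 n22} →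
    m00 ≈ n00 → m01 ≈ n01 → m02 ≈ n02 → m10 ≈ n10 → m11 ≈ n11 → m12 ≈ n12 → m20 ≈ n20 → m21 ≈ n21 → m22 ≈ n22 →
    Det₀ m00 m01 m02 m10 m11 m12 m20 m21 m22 ≈ Det₀ n00 n01 n02 n10 n11 n12 n20 n21 n22
  Det₀-cong e00 e01 e02 e10 e11 e12 e20 e21 e22 =
    +-cong (−-cong (*-cong e00 (−-cong (*-cong e11 e22) (*-cong e12 e21))) (*-cong e01 (−-cong (*-cong e10 e22) (*-cong e12 e20))))
           (*-cong e02 (−-cong (*-cong e10 e21) (*-cong e11 e20)))
    where
    −-cong : ∀ {a b a' b'} → a ≈ a' → b ≈ b' → a - b ≈ a' - b'
    −-cong x y = +-cong x (-‿cong y)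

  D₀-cong : ∀ {a b d e f g a' b' d' e' f' g'} → a ≈ a' → b ≈ b' → d ≈ d' → e ≈ e' → f ≈ f' → g ≈ g' →
    D₀ a b d e f g ≈ D₀ a' b' d' e' f' g'
  D₀-cong ea eb ed ee ef eg = Det₀-cong ea eb ed eb ee ef ed ef eg

  NZ : Set (c ⊔ ℓ)
  NZ = Σ V3 NonZero3

  PN : NZ → NZ → Set (c ⊔ ℓ)
  PN u v = Prop3 (proj₁ u) (proj₁ v)

  module Form (a00 a01 a02 a11 a12 a22 : Carrier) where
    Q : V3 → Carrier
    Q x = Q₀ a00 a01 a02 a11 a12 a22 (x 0F) (x 1F) (x 2F)

    B : V3 → V3 → Carrier
    B x y = B₀ a00 a01 a02 a11 a12 a22 (x 0F) (x 1F) (x 2F) (y 0F) (y 1F) (y 2F)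

    detA : Carrier
    detA = D₀ a00 a01 a02 a11 a12 a22

    Q-cong : ∀ {x y} → (∀ i → x i ≈ y i) → Q x ≈ Q y
    Q-cong h = B₀-cong (h 0F) (h 1F) (h 2F) (h 0F) (h 1F) (h 2F)

    B-congʳ : ∀ x {y y'} → (∀ i → y i ≈ y' i) → B x y ≈ B x y'
    B-congʳ x h = B₀-cong refl refl refl (h 0F) (h 1F) (h 2F)

    Q-scale : ∀ {x y} (x∼y : Prop3 x y) → Q y ≈ (proj₁ x∼y * proj₁ x∼y) * Q x
    Q-scale {x} (t , _ , y≈tx) = trans (Q-cong y≈tx) (scale a00 a01 a02 a11 a12 a22 t (x 0F) (x 1F) (x 2F))
      where
      scale : ∀ a00 a01 a02 a11 a12 a22 t x0 x1 x2 →
        Q₀ a00 a01 a02 a11 a12 a22 (t * x0) (t * x1) (t * x2) ≈ (t * t) * Q₀ a00 a01 a02 a11 a12 a22 x0 x1 x2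
      scale = solve 10 (λ a00 a01 a02 a11 a12 a22 t x0 x1 x2 →
        :Quad a00 a01 a02 a11 a12 a22 (t :* x0) (t :* x1) (t :* x2) := (t :* t) :* :Quad a00 a01 a02 a11 a12 a22 x0 x1 x2) refl

    Q≈0-resp : ∀ {x y} → Prop3 x y → Q x ≈ 0# → Q y ≈ 0#
    Q≈0-resp x∼y Qx≈0 = trans (Q-scale x∼y) (x*0≈0 Qx≈0)

    B-scaleʳ : ∀ x y t → B x (λ i → t * y i) ≈ t * B x y
    B-scaleʳ x y t = scale a00 a01 a02 a11 a12 a22 (x 0F) (x 1F) (x 2F) (y 0F) (y 1F) (y 2F) t
      where
      scale : ∀ a00 a01 a02 a11 a12 a22 x0 x1 x2 y0 y1 y2 t →
        B₀ a00 a01 a02 a11 a12 a22 x0 x1 x2 (t * y0) (t * y1) (t * y2) ≈ t * B₀ a00 a01 a02 a11 a12 a22 x0 x1 x2 y0 y1 y2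
      scale = solve 13 (λ a00 a01 a02 a11 a12 a22 x0 x1 x2 y0 y1 y2 t →
        :Bilin a00 a01 a02 a11 a12 a22 x0 x1 x2 (t :* y0) (t :* y1) (t :* y2) := t :* :Bilin a00 a01 a02 a11 a12 a22 x0 x1 x2 y0 y1 y2) refl

    -- If a00 = 0 take
    -- e₀; if α = a00 a11 − a01² = 0 take (−a01, a00, 0); otherwise complete
    -- the square twice, reducing Q = 0 to α y₁² + y₂² = −a00 det A, which is
    -- solvable by two-squares.
    isotropic : detA ≉ 0# → Σ V3 λ p → NonZero3 p × Q p ≈ 0#
    isotropic detA≉0 with a00 ≟ 0#
    ... | yes a00≈0 = v3 1# 0# 0# , (λ h → 1≉0 (proj₁ h)) , trans (Q-e₀ a00 a01 a02 a11 a12 a22) a00≈0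
      where
      Q-e₀ : ∀ a00 a01 a02 a11 a12 a22 → Q₀ a00 a01 a02 a11 a12 a22 1# 0# 0# ≈ a00
      Q-e₀ = solve 6 (λ a00 a01 a02 a11 a12 a22 → :Quad a00 a01 a02 a11 a12 a22 :1 :0 :0 := a00) refl
    ... | no a00≉0 with (a00 * a11 - a01 * a01) ≟ 0#
    ...   | yes α≈0 = v3 (- a01) a00 0# , (λ h → a00≉0 (proj₁ (proj₂ h))) ,
                      trans (Q-minor a00 a01 a02 a11 a12 a22) (x*0≈0 α≈0)
      where
      Q-minor : ∀ a00 a01 a02 a11 a12 a22 → Q₀ a00 a01 a02 a11 a12 a22 (- a01) a00 0# ≈ a00 * (a00 * a11 - a01 * a01)
      Q-minor = solve 6 (λ a00 a01 a02 a11 a12 a22 → :Quad a00 a01 a02 a11 a12 a22 (:- a01) a00 :0 := a00 :* (a00 :* a11 :- a01 :* a01)) refl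
    ...   | no α≉0 with two-squares (a00 * a11 - a01 * a01) 1# (- (a00 * detA)) α≉0 1≉0
    ...     | y₁ , y₂ , solution = p , (λ z → *-≉0 a00≉0 α≉0 (proj₂ (proj₂ z))) , Qp≈0
      where
      α = a00 * a11 - a01 * a01
      β = a00 * a12 - a01 * a02
      p = v3 (α * y₁ - a01 * (y₂ - β) - a02 * α) (a00 * (y₂ - β)) (a00 * α)
      completed-square : ∀ a00 a01 a02 a11 a12 a22 y₁ y₂ →
        let α = a00 * a11 - a01 * a01 ; β = a00 * a12 - a01 * a02 in
        (a00 * α) * Q₀ a00 a01 a02 a11 a12 a22 (α * y₁ - a01 * (y₂ - β) - a02 * α) (a00 * (y₂ - β)) (a00 * α)
        ≈ ((a00 * α) * (a00 * α)) * (α * (y₁ * y₁) + y₂ * y₂ + a00 * D₀ a00 a01 a02 a11 a12 a22)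
      completed-square = solve 8 (λ a00 a01 a02 a11 a12 a22 y₁ y₂ →
        let α = a00 :* a11 :- a01 :* a01 ; β = a00 :* a12 :- a01 :* a02 in
        (a00 :* α) :* :Quad a00 a01 a02 a11 a12 a22 (α :* y₁ :- a01 :* (y₂ :- β) :- a02 :* α) (a00 :* (y₂ :- β)) (a00 :* α)
        := ((a00 :* α) :* (a00 :* α)) :* (α :* (y₁ :* y₁) :+ y₂ :* y₂ :+ a00 :* :SymDet a00 a01 a02 a11 a12 a22)) refl
      cancel : ∀ S Y X → ((- X - 1# * Y) + Y) + X ≈ 0#
      cancel = solve 3 (λ S Y X → ((:- X :- :1 :* Y) :+ Y) :+ X := :0) refl
      reduced : α * (y₁ * y₁) + y₂ * y₂ + a00 * detA ≈ 0#
      reduced = trans (+-congʳ (+-congʳ solution)) (cancel α (y₂ * y₂) (a00 * detA))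
      Qp≈0 : Q p ≈ 0#
      Qp≈0 = cancel-0 (a00 * α) (*-≉0 a00≉0 α≉0)
               (trans (completed-square a00 a01 a02 a11 a12 a22 y₁ y₂) (x*0≈0 reduced))

    gram-0 : ∀ g02 g12 g22 → D₀ 0# 0# g02 0# g12 g22 ≈ 0#
    gram-0 = solve 3 (λ g02 g12 g22 → :SymDet :0 :0 g02 :0 g12 g22 := :0) refl

    -- An isotropic p with p₀ ≠ 0 is not B-orthogonal to any isotropic vector
    -- (0, y₁, y₂) ≠ 0: otherwise the Gram matrix of the basis p, (0,y₁,y₂),
    -- eₖ, whose determinant is (p₀ yⱼ)² det A, would vanish.
    no-isotropic-line : detA ≉ 0# → (p : V3) → Q p ≈ 0# → p 0F ≉ 0# → ∀ y₁ y₂ → NonZero2 (y₁ , y₂) →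
                        Q (v3 0# y₁ y₂) ≈ 0# → B p (v3 0# y₁ y₂) ≈ 0# → ⊥
    no-isotropic-line detA≉0 p Qp≈0 p₀≉0 y₁ y₂ y≠0 Qy≈0 Bpy≈0 with y₁ ≟ 0#
    ... | no y₁≉0 = *-≉0 (sq-≉0 (*-≉0 p₀≉0 y₁≉0)) detA≉0
                      (trans (sym (gram-e₂ a00 a01 a02 a11 a12 a22 (p 0F) (p 1F) (p 2F) y₁ y₂))
                             (trans (D₀-cong Qp≈0 Bpy≈0 refl Qy≈0 refl refl) (gram-0 _ _ _)))
      where
      gram-e₂ : ∀ a00 a01 a02 a11 a12 a22 p0 p1 p2 y₁ y₂ →
        D₀ (Q₀ a00 a01 a02 a11 a12 a22 p0 p1 p2) (B₀ a00 a01 a02 a11 a12 a22 p0 p1 p2 0# y₁ y₂)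
           (B₀ a00 a01 a02 a11 a12 a22 p0 p1 p2 0# 0# 1#) (Q₀ a00 a01 a02 a11 a12 a22 0# y₁ y₂)
           (B₀ a00 a01 a02 a11 a12 a22 0# y₁ y₂ 0# 0# 1#) (B₀ a00 a01 a02 a11 a12 a22 0# 0# 1# 0# 0# 1#)
        ≈ ((p0 * y₁) * (p0 * y₁)) * D₀ a00 a01 a02 a11 a12 a22
      gram-e₂ = solve 11 (λ a00 a01 a02 a11 a12 a22 p0 p1 p2 y₁ y₂ → let B = :Bilin a00 a01 a02 a11 a12 a22 in
        :SymDet (B p0 p1 p2 p0 p1 p2) (B p0 p1 p2 :0 y₁ y₂) (B p0 p1 p2 :0 :0 :1) (B :0 y₁ y₂ :0 y₁ y₂) (B :0 y₁ y₂ :0 :0 :1) (B :0 :0 :1 :0 :0 :1)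
        := ((p0 :* y₁) :* (p0 :* y₁)) :* :SymDet a00 a01 a02 a11 a12 a22) refl
    ... | yes y₁≈0 with y₂ ≟ 0#
    ...   | yes y₂≈0 = y≠0 (y₁≈0 , y₂≈0)
    ...   | no y₂≉0 = *-≉0 (sq-≉0 (*-≉0 p₀≉0 y₂≉0)) detA≉0
                        (trans (sym (gram-e₁ a00 a01 a02 a11 a12 a22 (p 0F) (p 1F) (p 2F) y₁ y₂))
                               (trans (D₀-cong Qp≈0 Bpy≈0 refl Qy≈0 refl refl) (gram-0 _ _ _)))
      where
      gram-e₁ : ∀ a00 a01 a02 a11 a12 a22 p0 p1 p2 y₁ y₂ →
        D₀ (Q₀ a00 a01 a02 a11 a12 a22 p0 p1 p2) (B₀ a00 a01 a02 a11 a12 a22 p0 p1 p2 0# y₁ y₂)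
           (B₀ a00 a01 a02 a11 a12 a22 p0 p1 p2 0# 1# 0#) (Q₀ a00 a01 a02 a11 a12 a22 0# y₁ y₂)
           (B₀ a00 a01 a02 a11 a12 a22 0# y₁ y₂ 0# 1# 0#) (B₀ a00 a01 a02 a11 a12 a22 0# 1# 0# 0# 1# 0#)
        ≈ ((p0 * y₂) * (p0 * y₂)) * D₀ a00 a01 a02 a11 a12 a22
      gram-e₁ = solve 11 (λ a00 a01 a02 a11 a12 a22 p0 p1 p2 y₁ y₂ → let B = :Bilin a00 a01 a02 a11 a12 a22 in
        :SymDet (B p0 p1 p2 p0 p1 p2) (B p0 p1 p2 :0 y₁ y₂) (B p0 p1 p2 :0 :1 :0) (B :0 y₁ y₂ :0 y₁ y₂) (B :0 y₁ y₂ :0 :1 :0) (B :0 :1 :0 :0 :1 :0)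
        := ((p0 :* y₂) :* (p0 :* y₂)) :* :SymDet a00 a01 a02 a11 a12 a22) refl

    -- Odd characteristic: projection from an isotropic point p with p₀ ≠ 0.
    -- The line through p and y = (0, y₁, y₂) meets the conic again in
    --     project y = Q(y) p − 2 B(p, y) y,
    -- and conversely z is recovered (up to a scalar) from its shadow
    -- (p₀ z₁ − z₀ p₁, p₀ z₂ − z₀ p₂) on the plane x₀ = 0.
    module Odd (2≉0 : 1# + 1# ≉ 0#) (detA≉0 : detA ≉ 0#) (p : V3) (Qp≈0 : Q p ≈ 0#) (p₀≉0 : p 0F ≉ 0#) where
      two = 1# + 1#

      inPlane : Carrier × Carrier → V3
      inPlane (y₁ , y₂) = v3 0# y₁ y₂

      project : Carrier × Carrier → V3
      project y i = Q (inPlane y) * p i - (two * B p (inPlane y)) * inPlane y i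

      b₀ b₁ b₂ : Carrier
      b₀ = B p (v3 1# 0# 0#)
      b₁ = B p (v3 0# 1# 0#)
      b₂ = B p (v3 0# 0# 1#)

      B-inPlane : ∀ y → B p (inPlane y) ≈ b₁ * proj₁ y + b₂ * proj₂ y
      B-inPlane (y₁ , y₂) = linear a00 a01 a02 a11 a12 a22 (p 0F) (p 1F) (p 2F) y₁ y₂
        where
        linear : ∀ a00 a01 a02 a11 a12 a22 p0 p1 p2 y₁ y₂ →
          B₀ a00 a01 a02 a11 a12 a22 p0 p1 p2 0# y₁ y₂ ≈
          B₀ a00 a01 a02 a11 a12 a22 p0 p1 p2 0# 1# 0# * y₁ + B₀ a00 a01 a02 a11 a12 a22 p0 p1 p2 0# 0# 1# * y₂
        linear = solve 11 (λ a00 a01 a02 a11 a12 a22 p0 p1 p2 y₁ y₂ → let B = :Bilin a00 a01 a02 a11 a12 a22 in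
          B p0 p1 p2 :0 y₁ y₂ := B p0 p1 p2 :0 :1 :0 :* y₁ :+ B p0 p1 p2 :0 :0 :1 :* y₂) refl

      -- this linear form is not zero: otherwise Q(p) = p₀ b₀ forces b₀ = 0,
      -- and then det A · p₀ = Σ adj(A)₀ⱼ bⱼ = 0
      tangent-nonzero : NonZero2 (b₁ , b₂)
      tangent-nonzero (b₁≈0 , b₂≈0) =
        *-≉0 detA≉0 p₀≉0 (trans (adjugate-row a00 a01 a02 a11 a12 a22 (p 0F) (p 1F) (p 2F)) (trans (drop b₁≈0 b₂≈0) (x*0≈0 b₀≈0)))
        where
        drop : ∀ {a b d x y z} → y ≈ 0# → z ≈ 0# → a * x + (b * y + d * z) ≈ a * x
        drop {a} {b} {d} y≈0 z≈0 = trans (+-congˡ (trans (+-cong (x*0≈0 y≈0) (x*0≈0 z≈0)) (+-identityʳ 0#))) (+-identityʳ _)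
        Q-expand : ∀ a00 a01 a02 a11 a12 a22 p0 p1 p2 →
          Q₀ a00 a01 a02 a11 a12 a22 p0 p1 p2 ≈
            p0 * B₀ a00 a01 a02 a11 a12 a22 p0 p1 p2 1# 0# 0# + (p1 * B₀ a00 a01 a02 a11 a12 a22 p0 p1 p2 0# 1# 0# + p2 * B₀ a00 a01 a02 a11 a12 a22 p0 p1 p2 0# 0# 1#)
        Q-expand = solve 9 (λ a00 a01 a02 a11 a12 a22 p0 p1 p2 → let B = :Bilin a00 a01 a02 a11 a12 a22 in
          :Quad a00 a01 a02 a11 a12 a22 p0 p1 p2 := p0 :* B p0 p1 p2 :1 :0 :0 :+ (p1 :* B p0 p1 p2 :0 :1 :0 :+ p2 :* B p0 p1 p2 :0 :0 :1)) refl
        adjugate-row : ∀ a00 a01 a02 a11 a12 a22 p0 p1 p2 →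
          D₀ a00 a01 a02 a11 a12 a22 * p0 ≈
            (a11 * a22 - a12 * a12) * B₀ a00 a01 a02 a11 a12 a22 p0 p1 p2 1# 0# 0#
            + ((a02 * a12 - a01 * a22) * B₀ a00 a01 a02 a11 a12 a22 p0 p1 p2 0# 1# 0#
            + (a01 * a12 - a02 * a11) * B₀ a00 a01 a02 a11 a12 a22 p0 p1 p2 0# 0# 1#)
        adjugate-row = solve 9 (λ a00 a01 a02 a11 a12 a22 p0 p1 p2 → let B = :Bilin a00 a01 a02 a11 a12 a22 in
          :SymDet a00 a01 a02 a11 a12 a22 :* p0 :=
            (a11 :* a22 :- a12 :* a12) :* B p0 p1 p2 :1 :0 :0
            :+ ((a02 :* a12 :- a01 :* a22) :* B p0 p1 p2 :0 :1 :0
            :+ (a01 :* a12 :- a02 :* a11) :* B p0 p1 p2 :0 :0 :1)) refl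
        b₀≈0 : b₀ ≈ 0#
        b₀≈0 = cancel-0 (p 0F) p₀≉0 (trans (sym (drop b₁≈0 b₂≈0)) (trans (sym (Q-expand a00 a01 a02 a11 a12 a22 (p 0F) (p 1F) (p 2F))) Qp≈0))

      kernel-det : ∀ {y₁ y₂ z₁ z₂} → b₁ * y₁ + b₂ * y₂ ≈ 0# → b₁ * z₁ + b₂ * z₂ ≈ 0# → y₁ * z₂ ≈ y₂ * z₁
      kernel-det {y₁} {y₂} {z₁} {z₂} hy hz with b₁ ≟ 0#
      ... | no b₁≉0 = x-y≈0⇒x≈y (cancel-0 b₁ b₁≉0 (trans (via-b₁ b₁ b₂ y₁ y₂ z₁ z₂) (combination-0 hy hz)))
        where
        via-b₁ : ∀ b₁ b₂ y₁ y₂ z₁ z₂ → b₁ * (y₁ * z₂ - y₂ * z₁) ≈ z₂ * (b₁ * y₁ + b₂ * y₂) - y₂ * (b₁ * z₁ + b₂ * z₂)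
        via-b₁ = solve 6 (λ b₁ b₂ y₁ y₂ z₁ z₂ → b₁ :* (y₁ :* z₂ :- y₂ :* z₁) := z₂ :* (b₁ :* y₁ :+ b₂ :* y₂) :- y₂ :* (b₁ :* z₁ :+ b₂ :* z₂)) refl
      ... | yes b₁≈0 with b₂ ≟ 0#
      ...   | yes b₂≈0 = ⊥-elim (tangent-nonzero (b₁≈0 , b₂≈0))
      ...   | no b₂≉0 = x-y≈0⇒x≈y (cancel-0 b₂ b₂≉0 (trans (via-b₂ b₁ b₂ y₁ y₂ z₁ z₂) (combination-0 hz hy)))
        where
        via-b₂ : ∀ b₁ b₂ y₁ y₂ z₁ z₂ → b₂ * (y₁ * z₂ - y₂ * z₁) ≈ y₁ * (b₁ * z₁ + b₂ * z₂) - z₁ * (b₁ * y₁ + b₂ * y₂)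
        via-b₂ = solve 6 (λ b₁ b₂ y₁ y₂ z₁ z₂ → b₂ :* (y₁ :* z₂ :- y₂ :* z₁) := y₁ :* (b₁ :* z₁ :+ b₂ :* z₂) :- z₁ :* (b₁ :* y₁ :+ b₂ :* y₂)) refl

      -- the first coordinate of project y is Q(y) p₀
      Q≈0-if-first-0 : ∀ y → project y 0F ≈ 0# → Q (inPlane y) ≈ 0#
      Q≈0-if-first-0 y h₀ = cancel-0 (p 0F) p₀≉0 (trans (*-comm _ _) (trans (sym (first-coordinate _ _ _)) h₀))
        where
        first-coordinate : ∀ X p0 W → X * p0 - W * 0# ≈ X * p0
        first-coordinate = solve 3 (λ X p0 W → X :* p0 :- W :* :0 := X :* p0) refl

      -- project y ≠ 0: if B(p, y) = 0 then project y = Q(y) p, and Q(y) = 0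
      -- would contradict no-isotropic-line; otherwise the last two
      -- coordinates, which are −2B(p,y)·y, cannot both vanish
      project-nonzero : ∀ y → NonZero2 y → NonZero3 (project y)
      project-nonzero y y≠0 (h₀ , h₁ , h₂) with two * B p (inPlane y) ≟ 0#
      ... | yes 2B≈0 = no-isotropic-line detA≉0 p Qp≈0 p₀≉0 (proj₁ y) (proj₂ y) y≠0 (Q≈0-if-first-0 y h₀) (cancel-0 two 2≉0 2B≈0)
      ... | no 2B≉0 = y≠0 (cancel-0 _ 2B≉0 (from-coordinate h₁) , cancel-0 _ 2B≉0 (from-coordinate h₂))
        where
        rearrange : ∀ X a W b → W * b ≈ X * a - (X * a - W * b)
        rearrange = solve 4 (λ X a W b → W :* b := X :* a :- (X :* a :- W :* b)) refl
        from-coordinate : ∀ {a b} → Q (inPlane y) * a - two * B p (inPlane y) * b ≈ 0# → two * B p (inPlane y) * b ≈ 0#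
        from-coordinate h = trans (rearrange _ _ _ _) (trans (+-cong (0*x≈0 (Q≈0-if-first-0 y h₀)) (-‿≈0 h)) (+-identityʳ 0#))

      -- Q(X p − 2Y y) = X² Q(p) − 4XY B(p,y) + 4Y² Q(y), which vanishes for
      -- X = Q(y), Y = B(p,y) since Q(p) = 0
      project-on-conic : ∀ y → Q (project y) ≈ 0#
      project-on-conic y =
        trans (expand a00 a01 a02 a11 a12 a22 (p 0F) (p 1F) (p 2F) (proj₁ y) (proj₂ y) (Q (inPlane y)) (B p (inPlane y)))
              (trans (cancel (Q (inPlane y)) (B p (inPlane y)) (two * two) (Q p)) (x*0≈0 Qp≈0))
        where
        expand : ∀ a00 a01 a02 a11 a12 a22 p0 p1 p2 y₁ y₂ X Y →
          Q₀ a00 a01 a02 a11 a12 a22 (X * p0 - ((1# + 1#) * Y) * 0#) (X * p1 - ((1# + 1#) * Y) * y₁) (X * p2 - ((1# + 1#) * Y) * y₂)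
          ≈ ((X * X) * Q₀ a00 a01 a02 a11 a12 a22 p0 p1 p2 - (((1# + 1#) * (1# + 1#)) * (X * Y)) * B₀ a00 a01 a02 a11 a12 a22 p0 p1 p2 0# y₁ y₂)
            + (((1# + 1#) * (1# + 1#)) * (Y * Y)) * Q₀ a00 a01 a02 a11 a12 a22 0# y₁ y₂
        expand = solve 13 (λ a00 a01 a02 a11 a12 a22 p0 p1 p2 y₁ y₂ X Y →
          :Quad a00 a01 a02 a11 a12 a22 (X :* p0 :- (:2 :* Y) :* :0) (X :* p1 :- (:2 :* Y) :* y₁) (X :* p2 :- (:2 :* Y) :* y₂)
          := ((X :* X) :* :Quad a00 a01 a02 a11 a12 a22 p0 p1 p2 :- ((:2 :* :2) :* (X :* Y)) :* :Bilin a00 a01 a02 a11 a12 a22 p0 p1 p2 :0 y₁ y₂)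
            :+ ((:2 :* :2) :* (Y :* Y)) :* :Quad a00 a01 a02 a11 a12 a22 :0 y₁ y₂) refl
        cancel : ∀ X Y F Qp → ((X * X) * Qp - (F * (X * Y)) * Y) + (F * (Y * Y)) * X ≈ (X * X) * Qp
        cancel = solve 4 (λ X Y F Qp → ((X :* X) :* Qp :- (F :* (X :* Y)) :* Y) :+ (F :* (Y :* Y)) :* X := (X :* X) :* Qp) refl

      shadow : Fin 3 → V3 → Carrier
      shadow k z = p 0F * z k - z 0F * p k

      shadow-project : ∀ y k → shadow k (project y) ≈ - ((two * B p (inPlane y)) * p 0F) * inPlane y k
      shadow-project y k = identity (p 0F) (p k) (Q (inPlane y)) (two * B p (inPlane y)) (inPlane y k)
        where
        identity : ∀ p0 pk X W yk → p0 * (X * pk - W * yk) - (X * p0 - W * 0#) * pk ≈ - (W * p0) * yk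
        identity = solve 5 (λ p0 pk X W yk → p0 :* (X :* pk :- W :* yk) :- (X :* p0 :- W :* :0) :* pk := :- (W :* p0) :* yk) refl

      shadow-scale : ∀ {z z'} (z∼z' : Prop3 z z') k → shadow k z' ≈ proj₁ z∼z' * shadow k z
      shadow-scale {z} (t , _ , h) k = trans (+-cong (*-congˡ (h k)) (-‿cong (*-congʳ (h 0F)))) (identity (p 0F) (p k) t (z k) (z 0F))
        where
        identity : ∀ p0 pk t a b → p0 * (t * a) - (t * b) * pk ≈ t * (p0 * a - b * pk)
        identity = solve 5 (λ p0 pk t a b → p0 :* (t :* a) :- (t :* b) :* pk := t :* (p0 :* a :- b :* pk)) refl

      project-prop : ∀ y y' (pr : Prop3 (project y) (project y')) k →
                     B p (inPlane y') * inPlane y' k ≈ (proj₁ pr * B p (inPlane y)) * inPlane y k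
      project-prop y y' pr k = cancelˡ _ (-‿≉0 (*-≉0 2≉0 p₀≉0)) (begin
        - (two * p 0F) * (B p (inPlane y') * inPlane y' k)  ≈⟨ sym (regroup two _ (p 0F) _) ⟩
        - ((two * B p (inPlane y')) * p 0F) * inPlane y' k  ≈⟨ sym (shadow-project y' k) ⟩
        shadow k (project y')                               ≈⟨ shadow-scale pr k ⟩
        proj₁ pr * shadow k (project y)                     ≈⟨ *-congˡ (shadow-project y k) ⟩
        proj₁ pr * (- ((two * B p (inPlane y)) * p 0F) * inPlane y k)
                                                            ≈⟨ regroup-scaled two _ (p 0F) _ _ ⟩
        - (two * p 0F) * ((proj₁ pr * B p (inPlane y)) * inPlane y k) ∎)
        where
        regroup : ∀ two Y p0 y → - ((two * Y) * p0) * y ≈ - (two * p0) * (Y * y)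
        regroup = solve 4 (λ two Y p0 y → :- ((two :* Y) :* p0) :* y := :- (two :* p0) :* (Y :* y)) refl
        regroup-scaled : ∀ two Y p0 y t → t * (- ((two * Y) * p0) * y) ≈ - (two * p0) * ((t * Y) * y)
        regroup-scaled = solve 5 (λ two Y p0 y t → t :* (:- ((two :* Y) :* p0) :* y) := :- (two :* p0) :* ((t :* Y) :* y)) refl

      project-inj : ∀ y y' → NonZero2 y → NonZero2 y' → Prop3 (project y) (project y') → Prop2 y y'
      project-inj y y' y≠0 y'≠0 pr with B p (inPlane y) ≟ 0# | B p (inPlane y') ≟ 0#
      ... | yes By≈0 | yes By'≈0 =
        det2≈0⇒Prop2 y≠0 y'≠0 (kernel-det (trans (sym (B-inPlane y)) By≈0) (trans (sym (B-inPlane y')) By'≈0))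
      ... | yes By≈0 | no By'≉0 = ⊥-elim (y'≠0 (y'-zero 1F , y'-zero 2F))
        where
        y'-zero : ∀ k → inPlane y' k ≈ 0#
        y'-zero k = cancel-0 _ By'≉0 (trans (project-prop y y' pr k) (0*x≈0 (x*0≈0 By≈0)))
      ... | no By≉0 | yes By'≈0 = ⊥-elim (y≠0 (y-zero 1F , y-zero 2F))
        where
        y-zero : ∀ k → inPlane y k ≈ 0#
        y-zero k = cancel-0 _ (*-≉0 (proj₁ (proj₂ pr)) By≉0) (trans (sym (project-prop y y' pr k)) (0*x≈0 By'≈0))
      ... | no By≉0 | no By'≉0 = s , *-≉0 (inv-≉0 _ By'≉0) (*-≉0 (proj₁ (proj₂ pr)) By≉0) , y'≈sy 1F , y'≈sy 2F
        where
        s = inv (B p (inPlane y')) By'≉0 * (proj₁ pr * B p (inPlane y))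
        y'≈sy : ∀ k → inPlane y' k ≈ s * inPlane y k
        y'≈sy k = trans (expand-invˡ _ By'≉0 _) (trans (*-congˡ (project-prop y y' pr k)) (sym (*-assoc _ _ _)))

      -- Every point z of the conic is a projection.  If its shadow w is
      -- nonzero, z ∼ project w; if the shadow vanishes, z ∼ p, which is the
      -- projection of the tangent direction (b₂, −b₁).
      project-surj-shadow : ∀ z → NonZero3 z → Q z ≈ 0# → NonZero2 (shadow 1F z , shadow 2F z) →
                            Σ (Fin (q ℕ.+ 1)) λ i → Prop3 (project (point1 i)) z
      project-surj-shadow z z≠0 Qz≈0 w≠0 = i , Prop3-trans project-y∼w (Prop3-sym z∼project-w)
        where
        w = (shadow 1F z , shadow 2F z)
        found = point1-surj (shadow 1F z) (shadow 2F z) w≠0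
        i = proj₁ found
        y = point1 i
        l = proj₁ (proj₂ found)
        l≉0 = proj₁ (proj₂ (proj₂ found))
        w≈ly : ∀ k → inPlane w k ≈ l * inPlane y k
        w≈ly 0F = sym (zeroʳ l)
        w≈ly 1F = proj₁ (proj₂ (proj₂ (proj₂ found)))
        w≈ly 2F = proj₂ (proj₂ (proj₂ (proj₂ found)))
        Bz = B p z
        Q-shadow-id : ∀ a00 a01 a02 a11 a12 a22 p0 p1 p2 z0 z1 z2 →
          Q₀ a00 a01 a02 a11 a12 a22 0# (p0 * z1 - z0 * p1) (p0 * z2 - z0 * p2)
          ≈ ((p0 * p0) * Q₀ a00 a01 a02 a11 a12 a22 z0 z1 z2 - (((1# + 1#) * p0) * z0) * B₀ a00 a01 a02 a11 a12 a22 p0 p1 p2 z0 z1 z2)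
            + (z0 * z0) * Q₀ a00 a01 a02 a11 a12 a22 p0 p1 p2
        Q-shadow-id = solve 12 (λ a00 a01 a02 a11 a12 a22 p0 p1 p2 z0 z1 z2 →
          let Q = :Quad a00 a01 a02 a11 a12 a22 ; B = :Bilin a00 a01 a02 a11 a12 a22 in
          Q :0 (p0 :* z1 :- z0 :* p1) (p0 :* z2 :- z0 :* p2)
          := ((p0 :* p0) :* Q z0 z1 z2 :- ((:2 :* p0) :* z0) :* B p0 p1 p2 z0 z1 z2) :+ (z0 :* z0) :* Q p0 p1 p2) refl
        B-shadow-id : ∀ a00 a01 a02 a11 a12 a22 p0 p1 p2 z0 z1 z2 →
          B₀ a00 a01 a02 a11 a12 a22 p0 p1 p2 0# (p0 * z1 - z0 * p1) (p0 * z2 - z0 * p2)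
          ≈ p0 * B₀ a00 a01 a02 a11 a12 a22 p0 p1 p2 z0 z1 z2 - z0 * Q₀ a00 a01 a02 a11 a12 a22 p0 p1 p2
        B-shadow-id = solve 12 (λ a00 a01 a02 a11 a12 a22 p0 p1 p2 z0 z1 z2 →
          let Q = :Quad a00 a01 a02 a11 a12 a22 ; B = :Bilin a00 a01 a02 a11 a12 a22 in
          B p0 p1 p2 :0 (p0 :* z1 :- z0 :* p1) (p0 :* z2 :- z0 :* p2) := p0 :* B p0 p1 p2 z0 z1 z2 :- z0 :* Q p0 p1 p2) refl
        Q-w : Q (inPlane w) ≈ ((p 0F * p 0F) * Q z - ((two * p 0F) * z 0F) * Bz) + (z 0F * z 0F) * Q p
        Q-w = Q-shadow-id a00 a01 a02 a11 a12 a22 (p 0F) (p 1F) (p 2F) (z 0F) (z 1F) (z 2F)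
        B-w : B p (inPlane w) ≈ p 0F * Bz - z 0F * Q p
        B-w = B-shadow-id a00 a01 a02 a11 a12 a22 (p 0F) (p 1F) (p 2F) (z 0F) (z 1F) (z 2F)
        -- B(p, z) ≠ 0, for otherwise w would span an isotropic line with p
        Bz≉0 : Bz ≉ 0#
        Bz≉0 Bz≈0 = no-isotropic-line detA≉0 p Qp≈0 p₀≉0 _ _ w≠0
          (trans Q-w (trans (+-cong (+-cong (x*0≈0 Qz≈0) (-‿≈0 (x*0≈0 Bz≈0))) (x*0≈0 Qp≈0))
                            (trans (+-identityʳ _) (+-identityʳ 0#))))
          (trans B-w (combination-0 Bz≈0 Qp≈0))
        μ = - ((two * (p 0F * p 0F)) * Bz)
        z∼project-w : Prop3 z (project w)
        z∼project-w = μ , -‿≉0 (*-≉0 (*-≉0 2≉0 (sq-≉0 p₀≉0)) Bz≉0) , coordinate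
          where
          at-k : ∀ p0 pk z0 zk Qz Bz Qp →
            ((p0 * p0) * Qz - (((1# + 1#) * p0) * z0) * Bz + (z0 * z0) * Qp) * pk - ((1# + 1#) * (p0 * Bz - z0 * Qp)) * (p0 * zk - z0 * pk)
            ≈ (- (((1# + 1#) * (p0 * p0)) * Bz)) * zk + (Qz * ((p0 * p0) * pk) + Qp * (((1# + 1#) * z0) * (p0 * zk) - (z0 * z0) * pk))
          at-k = solve 7 (λ p0 pk z0 zk Qz Bz Qp →
            ((p0 :* p0) :* Qz :- ((:2 :* p0) :* z0) :* Bz :+ (z0 :* z0) :* Qp) :* pk :- (:2 :* (p0 :* Bz :- z0 :* Qp)) :* (p0 :* zk :- z0 :* pk)
            := (:- ((:2 :* (p0 :* p0)) :* Bz)) :* zk :+ (Qz :* ((p0 :* p0) :* pk) :+ Qp :* ((:2 :* z0) :* (p0 :* zk) :- (z0 :* z0) :* pk))) refl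
          at-0 : ∀ p0 z0 Qz Bz Qp →
            ((p0 * p0) * Qz - (((1# + 1#) * p0) * z0) * Bz + (z0 * z0) * Qp) * p0 - ((1# + 1#) * (p0 * Bz - z0 * Qp)) * 0#
            ≈ (- (((1# + 1#) * (p0 * p0)) * Bz)) * z0 + (Qz * ((p0 * p0) * p0) + Qp * (((1# + 1#) * z0) * (p0 * z0) - (z0 * z0) * p0))
          at-0 = solve 5 (λ p0 z0 Qz Bz Qp →
            ((p0 :* p0) :* Qz :- ((:2 :* p0) :* z0) :* Bz :+ (z0 :* z0) :* Qp) :* p0 :- (:2 :* (p0 :* Bz :- z0 :* Qp)) :* :0
            := (:- ((:2 :* (p0 :* p0)) :* Bz)) :* z0 :+ (Qz :* ((p0 :* p0) :* p0) :+ Qp :* ((:2 :* z0) :* (p0 :* z0) :- (z0 :* z0) :* p0))) refl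
          drop : ∀ {m x a b} → m * x + (Q z * a + Q p * b) ≈ m * x
          drop {a = a} {b} = trans (+-congˡ (trans (+-cong (0*x≈0 Qz≈0) (0*x≈0 Qp≈0)) (+-identityʳ 0#))) (+-identityʳ _)
          coordinate : ∀ k → project w k ≈ μ * z k
          coordinate 0F = trans (+-cong (*-congʳ Q-w) (-‿cong (*-congʳ (*-congˡ B-w)))) (trans (at-0 (p 0F) (z 0F) (Q z) Bz (Q p)) drop)
          coordinate 1F = trans (+-cong (*-congʳ Q-w) (-‿cong (*-congʳ (*-congˡ B-w)))) (trans (at-k (p 0F) (p 1F) (z 0F) (z 1F) (Q z) Bz (Q p)) drop)
          coordinate 2F = trans (+-cong (*-congʳ Q-w) (-‿cong (*-congʳ (*-congˡ B-w)))) (trans (at-k (p 0F) (p 2F) (z 0F) (z 2F) (Q z) Bz (Q p)) drop)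
        -- project is homogeneous of degree 2: project (l y) = l² project y
        project-y∼w : Prop3 (project y) (project w)
        project-y∼w = l * l , sq-≉0 l≉0 , λ k → trans
          (+-cong (*-congʳ (Q-scale (l , l≉0 , w≈ly)))
                  (-‿cong (*-cong (*-congˡ (trans (B-congʳ p w≈ly) (B-scaleʳ p (inPlane y) l))) (w≈ly k))))
          (homogeneous l (Q (inPlane y)) (B p (inPlane y)) (p k) (inPlane y k))
          where
          homogeneous : ∀ l X Y pk yk → ((l * l) * X) * pk - (two * (l * Y)) * (l * yk) ≈ (l * l) * (X * pk - (two * Y) * yk)
          homogeneous = solve 5 (λ l X Y pk yk → ((l :* l) :* X) :* pk :- (:2 :* (l :* Y)) :* (l :* yk) := (l :* l) :* (X :* pk :- (:2 :* Y) :* yk)) refl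

      project-surj-p : ∀ z → NonZero3 z → shadow 1F z ≈ 0# → shadow 2F z ≈ 0# → Σ (Fin (q ℕ.+ 1)) λ i → Prop3 (project (point1 i)) z
      project-surj-p z z≠0 s₁≈0 s₂≈0 = i , Prop3-trans p∼project-y p∼z
        where
        shadow-0 : ∀ k → p 0F * z k ≈ z 0F * p k
        shadow-0 0F = *-comm _ _
        shadow-0 1F = x-y≈0⇒x≈y s₁≈0
        shadow-0 2F = x-y≈0⇒x≈y s₂≈0
        z₀≉0 : z 0F ≉ 0#
        z₀≉0 z₀≈0 = z≠0 (z₀≈0 , zero-at 1F , zero-at 2F)
          where
          zero-at : ∀ k → z k ≈ 0#
          zero-at k = cancel-0 (p 0F) p₀≉0 (trans (shadow-0 k) (0*x≈0 z₀≈0))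
        p∼z : Prop3 p z
        p∼z = inv (p 0F) p₀≉0 * z 0F , *-≉0 (inv-≉0 _ p₀≉0) z₀≉0 ,
              λ k → trans (expand-invˡ (p 0F) p₀≉0 (z k)) (trans (*-congˡ (shadow-0 k)) (sym (*-assoc _ _ _)))
        tangent = point1-surj b₂ (- b₁) (λ { (b₂≈0 , -b₁≈0) → tangent-nonzero (trans (sym (-‿involutive b₁)) (-‿≈0 -b₁≈0) , b₂≈0) })
        i = proj₁ tangent
        y = point1 i
        l = proj₁ (proj₂ tangent)
        l≉0 = proj₁ (proj₂ (proj₂ tangent))
        By≈0 : B p (inPlane y) ≈ 0#
        By≈0 = cancel-0 l l≉0 (trans (*-congˡ (B-inPlane y)) (trans (distribute l b₁ b₂ _ _)
                 (trans (+-cong (*-congˡ (sym (proj₁ (proj₂ (proj₂ (proj₂ tangent)))))) (*-congˡ (sym (proj₂ (proj₂ (proj₂ (proj₂ tangent)))))))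
                 (orthogonal b₁ b₂))))
          where
          distribute : ∀ l b₁ b₂ y₁ y₂ → l * (b₁ * y₁ + b₂ * y₂) ≈ b₁ * (l * y₁) + b₂ * (l * y₂)
          distribute = solve 5 (λ l b₁ b₂ y₁ y₂ → l :* (b₁ :* y₁ :+ b₂ :* y₂) := b₁ :* (l :* y₁) :+ b₂ :* (l :* y₂)) refl
          orthogonal : ∀ b₁ b₂ → b₁ * b₂ + b₂ * (- b₁) ≈ 0#
          orthogonal = solve 2 (λ b₁ b₂ → b₁ :* b₂ :+ b₂ :* (:- b₁) := :0) refl
        Qy≉0 : Q (inPlane y) ≉ 0#
        Qy≉0 Qy≈0 = no-isotropic-line detA≉0 p Qp≈0 p₀≉0 (proj₁ y) (proj₂ y) (point1-nonzero i) Qy≈0 By≈0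
        p∼project-y : Prop3 (project y) p
        p∼project-y = inv _ Qy≉0 , inv-≉0 _ Qy≉0 , λ k → trans (expand-invˡ _ Qy≉0 (p k)) (*-congˡ (sym (trans
          (+-congˡ (-‿≈0 (0*x≈0 (x*0≈0 By≈0)))) (+-identityʳ _))))

      project-surj : ∀ z → NonZero3 z → Q z ≈ 0# → Σ (Fin (q ℕ.+ 1)) λ i → Prop3 (project (point1 i)) z
      project-surj z z≠0 Qz≈0 with shadow 1F z ≟ 0# | shadow 2F z ≟ 0#
      ... | yes s₁≈0 | yes s₂≈0 = project-surj-p z z≠0 s₁≈0 s₂≈0
      ... | yes _    | no s₂≉0  = project-surj-shadow z z≠0 Qz≈0 (λ h → s₂≉0 (proj₂ h))
      ... | no s₁≉0  | _        = project-surj-shadow z z≠0 Qz≈0 (λ h → s₁≉0 (proj₁ h))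

      odd-count : Exactly NZ PN (λ u → Q (proj₁ u) ≈ 0#) (q ℕ.+ 1)
      odd-count = transport-Fin {E = PN} Prop3-refl Prop3-trans (all-of-Fin (q ℕ.+ 1)) point
                    (λ i _ → project-on-conic (point1 i)) point-inj point-surj
        where
        point : Fin (q ℕ.+ 1) → NZ
        point i = project (point1 i) , project-nonzero (point1 i) (point1-nonzero i)
        point-inj : ∀ i j → ⊤ → ⊤ → PN (point i) (point j) → i ≡ j
        point-inj i j _ _ pr = point1-inj i j (project-inj _ _ (point1-nonzero i) (point1-nonzero j) pr)
        point-surj : ∀ z → Q (proj₁ z) ≈ 0# → Σ (Fin (q ℕ.+ 1)) λ i → ⊤ × PN z (point i)
        point-surj (z , z≠0) Qz≈0 = proj₁ (project-surj z z≠0 Qz≈0) , tt , Prop3-sym (proj₂ (project-surj z z≠0 Qz≈0))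

    -- Characteristic 2 with a00 ≠ 0: Q(x) = a00 x₀² + a11 x₁² + a22 x₂²,
    -- and the conic is {(r(y) : y₁ : y₂) | (y₁ : y₂) ∈ PG(1,q)} where r(y)
    -- is the square root of −(a11 y₁² + a22 y₂²)/a00.
    module Char2 (2≈0 : 1# + 1# ≈ 0#) (a00≉0 : a00 ≉ 0#) where
      open Characteristic2 2≈0

      Q-diagonal : ∀ x → Q x ≈ a00 * (x 0F * x 0F) + (a11 * (x 1F * x 1F) + a22 * (x 2F * x 2F))
      Q-diagonal x = trans (expand a00 a01 a02 a11 a12 a22 (x 0F) (x 1F) (x 2F))
                           (trans (+-congˡ (0*x≈0 2≈0)) (trans (+-identityʳ _) (+-assoc _ _ _)))
        where
        expand : ∀ a00 a01 a02 a11 a12 a22 x0 x1 x2 → Q₀ a00 a01 a02 a11 a12 a22 x0 x1 x2 ≈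
          ((a00 * (x0 * x0) + a11 * (x1 * x1)) + a22 * (x2 * x2)) + (1# + 1#) * ((a01 * (x0 * x1) + a02 * (x0 * x2)) + a12 * (x1 * x2))
        expand = solve 9 (λ a00 a01 a02 a11 a12 a22 x0 x1 x2 → :Quad a00 a01 a02 a11 a12 a22 x0 x1 x2 :=
          ((a00 :* (x0 :* x0) :+ a11 :* (x1 :* x1)) :+ a22 :* (x2 :* x2)) :+ :2 :* ((a01 :* (x0 :* x1) :+ a02 :* (x0 :* x2)) :+ a12 :* (x1 :* x2))) refl

      tail : Carrier × Carrier → Carrier
      tail (y₁ , y₂) = a11 * (y₁ * y₁) + a22 * (y₂ * y₂)

      r : Carrier × Carrier → Carrier
      r y = sqrt (- (tail y * inv a00 a00≉0))

      lift-point : Carrier × Carrier → V3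
      lift-point y = v3 (r y) (proj₁ y) (proj₂ y)

      a00-r² : ∀ y → a00 * (r y * r y) ≈ - tail y
      a00-r² y = begin
        a00 * (r y * r y)                 ≈⟨ *-congˡ (sqrt-sq _) ⟩
        a00 * (- (tail y * inv a00 a00≉0)) ≈⟨ regroup a00 (tail y) _ ⟩
        - (tail y * (a00 * inv a00 a00≉0)) ≈⟨ -‿cong (trans (*-congˡ (inv-r a00 a00≉0)) (*-identityʳ _)) ⟩
        - tail y                          ∎
        where
        regroup : ∀ a s i → a * (- (s * i)) ≈ - (s * (a * i))
        regroup = solve 3 (λ a s i → a :* (:- (s :* i)) := :- (s :* (a :* i))) refl

      lift-on-conic : ∀ y → Q (lift-point y) ≈ 0#
      lift-on-conic y = trans (Q-diagonal (lift-point y)) (trans (+-congʳ (a00-r² y)) (-‿inverseˡ (tail y)))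

      lift-surj : ∀ z → NonZero3 z → Q z ≈ 0# → Σ (Fin (q ℕ.+ 1)) λ i → Prop3 (lift-point (point1 i)) z
      lift-surj z z≠0 Qz≈0 = i , l , l≉0 , coordinate
        where
        a00z₀² : a00 * (z 0F * z 0F) ≈ - tail (z 1F , z 2F)
        a00z₀² = x+y≈0⇒x≈-y (trans (sym (Q-diagonal z)) Qz≈0)
        tail≠0 : NonZero2 (z 1F , z 2F)
        tail≠0 (z₁≈0 , z₂≈0) = z≠0 (z₀≈0 , z₁≈0 , z₂≈0)
          where
          z₀≈0 : z 0F ≈ 0#
          z₀≈0 = sq≈0 (cancel-0 a00 a00≉0 (trans a00z₀² (-‿≈0 (trans (+-cong (x*0≈0 (0*x≈0 z₁≈0)) (x*0≈0 (0*x≈0 z₂≈0))) (+-identityʳ 0#)))))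
        found = point1-surj (z 1F) (z 2F) tail≠0
        i = proj₁ found
        y = point1 i
        l = proj₁ (proj₂ found)
        l≉0 = proj₁ (proj₂ (proj₂ found))
        z₁≈ly₁ = proj₁ (proj₂ (proj₂ (proj₂ found)))
        z₂≈ly₂ = proj₂ (proj₂ (proj₂ (proj₂ found)))
        tail-scale : ∀ a11 a22 l y₁ y₂ → a11 * ((l * y₁) * (l * y₁)) + a22 * ((l * y₂) * (l * y₂)) ≈ (l * l) * (a11 * (y₁ * y₁) + a22 * (y₂ * y₂))
        tail-scale = solve 5 (λ a11 a22 l y₁ y₂ → a11 :* ((l :* y₁) :* (l :* y₁)) :+ a22 :* ((l :* y₂) :* (l :* y₂)) := (l :* l) :* (a11 :* (y₁ :* y₁) :+ a22 :* (y₂ :* y₂))) refl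
        head-scale : ∀ a l r → a * ((l * r) * (l * r)) ≈ (l * l) * (a * (r * r))
        head-scale = solve 3 (λ a l r → a :* ((l :* r) :* (l :* r)) := (l :* l) :* (a :* (r :* r))) refl
        z₀≈lr : z 0F ≈ l * r y
        z₀≈lr = sq-injective (cancelˡ a00 a00≉0 (begin
          a00 * (z 0F * z 0F)                 ≈⟨ a00z₀² ⟩
          - tail (z 1F , z 2F)                ≈⟨ -‿cong (+-cong (*-congˡ (*-cong z₁≈ly₁ z₁≈ly₁)) (*-congˡ (*-cong z₂≈ly₂ z₂≈ly₂))) ⟩
          - (a11 * ((l * proj₁ y) * (l * proj₁ y)) + a22 * ((l * proj₂ y) * (l * proj₂ y)))
                                              ≈⟨ -‿cong (tail-scale a11 a22 l _ _) ⟩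
          - ((l * l) * tail y)                ≈⟨ -‿distribʳ-* _ _ ⟩
          (l * l) * (- tail y)                ≈⟨ *-congˡ (sym (a00-r² y)) ⟩
          (l * l) * (a00 * (r y * r y))       ≈⟨ sym (head-scale a00 l (r y)) ⟩
          a00 * ((l * r y) * (l * r y))       ∎))
        coordinate : ∀ k → z k ≈ l * lift-point y k
        coordinate 0F = z₀≈lr
        coordinate 1F = z₁≈ly₁
        coordinate 2F = z₂≈ly₂

      char2-count : Exactly NZ PN (λ u → Q (proj₁ u) ≈ 0#) (q ℕ.+ 1)
      char2-count = transport-Fin {E = PN} Prop3-refl Prop3-trans (all-of-Fin (q ℕ.+ 1)) point
                      (λ i _ → lift-on-conic (point1 i)) point-inj point-surj
        where
        point : Fin (q ℕ.+ 1) → NZ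
        point i = lift-point (point1 i) , λ { (_ , z₁ , z₂) → point1-nonzero i (z₁ , z₂) }
        point-inj : ∀ i j → ⊤ → ⊤ → PN (point i) (point j) → i ≡ j
        point-inj i j _ _ (t , t≉0 , h) = point1-inj i j (t , t≉0 , h 1F , h 2F)
        point-surj : ∀ z → Q (proj₁ z) ≈ 0# → Σ (Fin (q ℕ.+ 1)) λ i → ⊤ × PN z (point i)
        point-surj (z , z≠0) Qz≈0 = proj₁ (lift-surj z z≠0 Qz≈0) , tt , Prop3-sym (proj₂ (lift-surj z z≠0 Qz≈0))

  -- Rotating coordinates (x₀, x₁, x₂) ↦ (x₁, x₂, x₀) turns the form with
  -- upper triangle (a22 a02 a12 a00 a01 a11) into the one with (a00 … a22);
  -- this lets us move a nonzero coordinate into position 0.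
  rotate : V3 → V3
  rotate x 0F = x 1F
  rotate x 1F = x 2F
  rotate x 2F = x 0F

  Q-rotate : ∀ a00 a01 a02 a11 a12 a22 x → Form.Q a22 a02 a12 a00 a01 a11 x ≈ Form.Q a00 a01 a02 a11 a12 a22 (rotate x)
  Q-rotate a00 a01 a02 a11 a12 a22 x = identity a00 a01 a02 a11 a12 a22 (x 0F) (x 1F) (x 2F)
    where
    identity : ∀ a00 a01 a02 a11 a12 a22 x0 x1 x2 → Q₀ a22 a02 a12 a00 a01 a11 x0 x1 x2 ≈ Q₀ a00 a01 a02 a11 a12 a22 x1 x2 x0
    identity = solve 9 (λ a00 a01 a02 a11 a12 a22 x0 x1 x2 →
      :Quad a22 a02 a12 a00 a01 a11 x0 x1 x2 := :Quad a00 a01 a02 a11 a12 a22 x1 x2 x0) refl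

  det-rotate : ∀ a00 a01 a02 a11 a12 a22 → D₀ a22 a02 a12 a00 a01 a11 ≈ D₀ a00 a01 a02 a11 a12 a22
  det-rotate = solve 6 (λ a00 a01 a02 a11 a12 a22 → :SymDet a22 a02 a12 a00 a01 a11 := :SymDet a00 a01 a02 a11 a12 a22) refl

  count-rotate : ∀ a00 a01 a02 a11 a12 a22 {n} →
    Exactly NZ PN (λ u → Form.Q a22 a02 a12 a00 a01 a11 (proj₁ u) ≈ 0#) n →
    Exactly NZ PN (λ u → Form.Q a00 a01 a02 a11 a12 a22 (proj₁ u) ≈ 0#) n
  count-rotate a00 a01 a02 a11 a12 a22 count = transport {E = PN} Prop3-trans count rot on-conic reflects preserves surj
    where
    rot : NZ → NZ
    rot (x , x≠0) = rotate x , λ { (z₀ , z₁ , z₂) → x≠0 (z₂ , z₀ , z₁) }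
    on-conic : ∀ u → Form.Q a22 a02 a12 a00 a01 a11 (proj₁ u) ≈ 0# → Form.Q a00 a01 a02 a11 a12 a22 (proj₁ (rot u)) ≈ 0#
    on-conic (x , _) Qx≈0 = trans (sym (Q-rotate a00 a01 a02 a11 a12 a22 x)) Qx≈0
    reflects : ∀ u v → _ → _ → PN (rot u) (rot v) → PN u v
    reflects _ _ _ _ (t , t≉0 , h) = t , t≉0 , λ { 0F → h 2F ; 1F → h 0F ; 2F → h 1F }
    preserves : ∀ u v → _ → _ → PN u v → PN (rot u) (rot v)
    preserves _ _ _ _ (t , t≉0 , h) = t , t≉0 , λ { 0F → h 1F ; 1F → h 2F ; 2F → h 0F }
    surj : ∀ z → Form.Q a00 a01 a02 a11 a12 a22 (proj₁ z) ≈ 0# → Σ NZ λ x → Form.Q a22 a02 a12 a00 a01 a11 (proj₁ x) ≈ 0# × PN z (rot x)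
    surj (z , z≠0) Qz≈0 = (rotate (rotate z) , λ { (z₀ , z₁ , z₂) → z≠0 (z₁ , z₂ , z₀) }) ,
                          trans (Q-rotate a00 a01 a02 a11 a12 a22 (rotate (rotate z))) Qz≈0 ,
                          (1# , 1≉0 , λ { 0F → sym (*-identityˡ _) ; 1F → sym (*-identityˡ _) ; 2F → sym (*-identityˡ _) })

  -- characteristic 2: some diagonal coefficient is nonzero, for otherwise
  -- det A = 2 a01 a02 a12 = 0
  char2-conic-count : ∀ a00 a01 a02 a11 a12 a22 → 1# + 1# ≈ 0# → D₀ a00 a01 a02 a11 a12 a22 ≉ 0# →
    Exactly NZ PN (λ u → Form.Q a00 a01 a02 a11 a12 a22 (proj₁ u) ≈ 0#) (q ℕ.+ 1)
  char2-conic-count a00 a01 a02 a11 a12 a22 2≈0 detA≉0 with a00 ≟ 0# | a11 ≟ 0# | a22 ≟ 0#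
  ... | no a00≉0 | _ | _ = Form.Char2.char2-count a00 a01 a02 a11 a12 a22 2≈0 a00≉0
  ... | yes _ | _ | no a22≉0 =
    count-rotate a00 a01 a02 a11 a12 a22 (Form.Char2.char2-count a22 a02 a12 a00 a01 a11 2≈0 a22≉0)
  ... | yes _ | no a11≉0 | yes _ =
    count-rotate a00 a01 a02 a11 a12 a22 (count-rotate a22 a02 a12 a00 a01 a11 (Form.Char2.char2-count a11 a12 a01 a22 a02 a00 2≈0 a11≉0))
  ... | yes a00≈0 | yes a11≈0 | yes a22≈0 = ⊥-elim (detA≉0 (trans (D₀-cong a00≈0 refl refl a11≈0 refl a22≈0)
                                                         (trans (off-diagonal a01 a02 a12) (0*x≈0 2≈0))))
    where
    off-diagonal : ∀ b d e → D₀ 0# b d 0# e 0# ≈ (1# + 1#) * (b * (d * e))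
    off-diagonal = solve 3 (λ b d e → :SymDet :0 b d :0 e :0 := :2 :* (b :* (d :* e))) refl

  -- odd characteristic: an isotropic vector exists, and we rotate one of its
  -- nonzero coordinates into position 0
  odd-conic-count : ∀ a00 a01 a02 a11 a12 a22 → 1# + 1# ≉ 0# → D₀ a00 a01 a02 a11 a12 a22 ≉ 0# →
    Exactly NZ PN (λ u → Form.Q a00 a01 a02 a11 a12 a22 (proj₁ u) ≈ 0#) (q ℕ.+ 1)
  odd-conic-count a00 a01 a02 a11 a12 a22 2≉0 detA≉0 with Form.isotropic a00 a01 a02 a11 a12 a22 detA≉0
  ... | p , p≠0 , Qp≈0 with p 0F ≟ 0# | p 1F ≟ 0# | p 2F ≟ 0#
  ...   | no p₀≉0 | _ | _ = Form.Odd.odd-count a00 a01 a02 a11 a12 a22 2≉0 detA≉0 p Qp≈0 p₀≉0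
  ...   | yes _ | _ | no p₂≉0 = count-rotate a00 a01 a02 a11 a12 a22
          (Form.Odd.odd-count a22 a02 a12 a00 a01 a11 2≉0 (λ h → detA≉0 (trans (sym (det-rotate a00 a01 a02 a11 a12 a22)) h))
             (rotate (rotate p)) (trans (Q-rotate a00 a01 a02 a11 a12 a22 (rotate (rotate p))) Qp≈0) p₂≉0)
  ...   | yes _ | no p₁≉0 | yes _ = count-rotate a00 a01 a02 a11 a12 a22 (count-rotate a22 a02 a12 a00 a01 a11
          (Form.Odd.odd-count a11 a12 a01 a22 a02 a00 2≉0
             (λ h → detA≉0 (trans (sym (det-rotate a00 a01 a02 a11 a12 a22)) (trans (sym (det-rotate a22 a02 a12 a00 a01 a11)) h)))
             (rotate p) (trans (Q-rotate a22 a02 a12 a00 a01 a11 (rotate p)) (trans (Q-rotate a00 a01 a02 a11 a12 a22 (rotate (rotate p))) Qp≈0)) p₁≉0))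
  ...   | yes p₀≈0 | yes p₁≈0 | yes p₂≈0 = ⊥-elim (p≠0 (p₀≈0 , p₁≈0 , p₂≈0))

  conic-count : ∀ a00 a01 a02 a11 a12 a22 → D₀ a00 a01 a02 a11 a12 a22 ≉ 0# →
    Exactly NZ PN (λ u → Form.Q a00 a01 a02 a11 a12 a22 (proj₁ u) ≈ 0#) (q ℕ.+ 1)
  conic-count a00 a01 a02 a11 a12 a22 detA≉0 with 1# + 1# ≟ 0#
  ... | yes 2≈0 = char2-conic-count a00 a01 a02 a11 a12 a22 2≈0 detA≉0
  ... | no 2≉0 = odd-conic-count a00 a01 a02 a11 a12 a22 2≉0 detA≉0

  count-on-PG2 : ∀ {p} (S : V3 → Set p) → (∀ {x y} → Prop3 x y → S x → S y) → ∀ {n} →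
    Exactly NZ PN (S ∘ proj₁) n → Exactly (Fin N2) _≡_ (S ∘ point2) n
  count-on-PG2 S S-resp count = transport {E = _≡_} ≡.trans count index2 on-index reflects preserves surj
    where
    index2 : NZ → Fin N2
    index2 (x , x≠0) = proj₁ (point2-surj x x≠0)
    index2-prop : ∀ u → Prop3 (point2 (index2 u)) (proj₁ u)
    index2-prop (x , x≠0) = proj₂ (point2-surj x x≠0)
    on-index : ∀ u → S (proj₁ u) → S (point2 (index2 u))
    on-index u = S-resp (Prop3-sym (index2-prop u))
    reflects : ∀ u v → _ → _ → index2 u ≡ index2 v → PN u v
    reflects u v _ _ eq = Prop3-trans (Prop3-sym (index2-prop u)) (≡.subst (λ i → Prop3 (point2 i) (proj₁ v)) (≡.sym eq) (index2-prop v))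
    preserves : ∀ u v → _ → _ → PN u v → index2 u ≡ index2 v
    preserves u v _ _ u∼v = point2-inj _ _ (Prop3-trans (index2-prop u) (Prop3-trans u∼v (Prop3-sym (index2-prop v))))
    surj : ∀ i → S (point2 i) → Σ NZ λ u → S (proj₁ u) × i ≡ index2 u
    surj i Si = (point2 i , point2-nonzero i) , Si , point2-inj _ _ (Prop3-sym (index2-prop (point2 i , point2-nonzero i)))

module Geometry {c ℓ} (R : CommutativeRing c ℓ) (q : ℕ) (ff : FieldDefs.IsFiniteField R q) where
  open Conic R q ff
  open Template
  open SymGeometry R hiding (sym)
  module SG = SymGeometry R

  -- "rank ≤ 1": all 2×2 minors vanish
  AllMinorsZero : Mat → Set ℓ
  AllMinorsZero M = ∀ i j k l → minor2 M i j k l ≈ 0#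

  det3-cong : ∀ {M N : Mat} → (∀ i j → M i j ≈ N i j) → det3 M ≈ det3 N
  det3-cong h = Det₀-cong (h _ _) (h _ _) (h _ _) (h _ _) (h _ _) (h _ _) (h _ _) (h _ _) (h _ _)

  minor2-cong : ∀ {M N : Mat} → (∀ i j → M i j ≈ N i j) → ∀ i j k l → minor2 M i j k l ≈ minor2 N i j k l
  minor2-cong h i j k l = +-cong (*-cong (h _ _) (h _ _)) (-‿cong (*-cong (h _ _) (h _ _)))

  -- Laplace expansion along the first row
  minors-zero⇒det-zero : ∀ M → AllMinorsZero M → det3 M ≈ 0#
  minors-zero⇒det-zero M z =
    trans (+-cong (+-cong (x*0≈0 (z 1F 2F 1F 2F)) (-‿≈0 (x*0≈0 (z 1F 2F 0F 2F)))) (x*0≈0 (z 1F 2F 0F 1F)))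
          (trans (+-identityʳ _) (+-identityʳ _))

  zero-minors-zero : ∀ M → (∀ i j → M i j ≈ 0#) → AllMinorsZero M
  zero-minors-zero M z i j k l = trans (minor2-cong z i j k l) (combination-0 refl refl)

  xxᵀ-minors-zero : ∀ s (x : V3) → AllMinorsZero (λ i j → s * (x i * x j))
  xxᵀ-minors-zero s x i j k l = identity s (x i) (x j) (x k) (x l)
    where
    identity : ∀ s a b d f → (s * (a * d)) * (s * (b * f)) - (s * (a * f)) * (s * (b * d)) ≈ 0#
    identity = solve 5 (λ s a b d f → (s :* (a :* d)) :* (s :* (b :* f)) :- (s :* (a :* f)) :* (s :* (b :* d)) := :0) refl

  -- det (M + s x xᵀ) = det M + s · xᵀ adj(M) x, and adj M = 0 when all
  -- minors vanish: a sum of two matrices of rank ≤ 1 is singular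
  rank≤1-sum-singular : ∀ M s (x : V3) → AllMinorsZero M → det3 (λ i j → M i j + s * (x i * x j)) ≈ 0#
  rank≤1-sum-singular M s x z =
    trans (expand _ _ _ _ _ _ _ _ _ s (x 0F) (x 1F) (x 2F))
          (trans (+-cong (minors-zero⇒det-zero M z) (x*0≈0 (cofactor-form-0 (z 1F 2F 1F 2F) (z 1F 2F 0F 2F) (z 1F 2F 0F 1F)
                   (z 0F 2F 1F 2F) (z 0F 2F 0F 2F) (z 0F 2F 0F 1F) (z 0F 1F 1F 2F) (z 0F 1F 0F 2F) (z 0F 1F 0F 1F))))
                 (+-identityʳ 0#))
    where
    μ : (a b d e : Carrier) → Carrier
    μ a b d e = a * b - d * e
    alternating : (w0 w1 w2 w3 w4 w5 w6 w7 w8 n0 n1 n2 n3 n4 n5 n6 n7 n8 : Carrier) → Carrier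
    alternating w0 w1 w2 w3 w4 w5 w6 w7 w8 n0 n1 n2 n3 n4 n5 n6 n7 n8 =
      w0 * n0 - w1 * n1 + w2 * n2 - w3 * n3 + w4 * n4 - w5 * n5 + w6 * n6 - w7 * n7 + w8 * n8
    expand : ∀ m00 m01 m02 m10 m11 m12 m20 m21 m22 s x0 x1 x2 →
      Det₀ (m00 + s * (x0 * x0)) (m01 + s * (x0 * x1)) (m02 + s * (x0 * x2))
           (m10 + s * (x1 * x0)) (m11 + s * (x1 * x1)) (m12 + s * (x1 * x2))
           (m20 + s * (x2 * x0)) (m21 + s * (x2 * x1)) (m22 + s * (x2 * x2))
      ≈ Det₀ m00 m01 m02 m10 m11 m12 m20 m21 m22 + s * alternating
          (x0 * x0) (x0 * x1) (x0 * x2) (x1 * x0) (x1 * x1) (x1 * x2) (x2 * x0) (x2 * x1) (x2 * x2)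
          (μ m11 m22 m12 m21) (μ m10 m22 m12 m20) (μ m10 m21 m11 m20) (μ m01 m22 m02 m21) (μ m00 m22 m02 m20)
          (μ m00 m21 m01 m20) (μ m01 m12 m02 m11) (μ m00 m12 m02 m10) (μ m00 m11 m01 m10)
    expand = solve 13 (λ m00 m01 m02 m10 m11 m12 m20 m21 m22 s x0 x1 x2 →
      :Det (m00 :+ s :* (x0 :* x0)) (m01 :+ s :* (x0 :* x1)) (m02 :+ s :* (x0 :* x2))
           (m10 :+ s :* (x1 :* x0)) (m11 :+ s :* (x1 :* x1)) (m12 :+ s :* (x1 :* x2))
           (m20 :+ s :* (x2 :* x0)) (m21 :+ s :* (x2 :* x1)) (m22 :+ s :* (x2 :* x2))
      := :Det m00 m01 m02 m10 m11 m12 m20 m21 m22 :+ s :* (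
          (x0 :* x0) :* (m11 :* m22 :- m12 :* m21) :- (x0 :* x1) :* (m10 :* m22 :- m12 :* m20)
          :+ (x0 :* x2) :* (m10 :* m21 :- m11 :* m20) :- (x1 :* x0) :* (m01 :* m22 :- m02 :* m21)
          :+ (x1 :* x1) :* (m00 :* m22 :- m02 :* m20) :- (x1 :* x2) :* (m00 :* m21 :- m01 :* m20)
          :+ (x2 :* x0) :* (m01 :* m12 :- m02 :* m11) :- (x2 :* x1) :* (m00 :* m12 :- m02 :* m10)
          :+ (x2 :* x2) :* (m00 :* m11 :- m01 :* m10))) refl
    cofactor-form-0 : ∀ {w0 w1 w2 w3 w4 w5 w6 w7 w8 n0 n1 n2 n3 n4 n5 n6 n7 n8} →
      n0 ≈ 0# → n1 ≈ 0# → n2 ≈ 0# → n3 ≈ 0# → n4 ≈ 0# → n5 ≈ 0# → n6 ≈ 0# → n7 ≈ 0# → n8 ≈ 0# →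
      alternating w0 w1 w2 w3 w4 w5 w6 w7 w8 n0 n1 n2 n3 n4 n5 n6 n7 n8 ≈ 0#
    cofactor-form-0 e0 e1 e2 e3 e4 e5 e6 e7 e8 = trans
      (+-cong (+-cong (+-cong (+-cong (+-cong (+-cong (+-cong (+-cong (*-congˡ e0) (-‿cong (*-congˡ e1))) (*-congˡ e2)) (-‿cong (*-congˡ e3)))
        (*-congˡ e4)) (-‿cong (*-congˡ e5))) (*-congˡ e6)) (-‿cong (*-congˡ e7))) (*-congˡ e8))
      (all-zero _ _ _ _ _ _ _ _ _)
      where
      all-zero : ∀ w0 w1 w2 w3 w4 w5 w6 w7 w8 → alternating w0 w1 w2 w3 w4 w5 w6 w7 w8 0# 0# 0# 0# 0# 0# 0# 0# 0# ≈ 0#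
      all-zero = solve 9 (λ w0 w1 w2 w3 w4 w5 w6 w7 w8 →
        w0 :* :0 :- w1 :* :0 :+ w2 :* :0 :- w3 :* :0 :+ w4 :* :0 :- w5 :* :0 :+ w6 :* :0 :- w7 :* :0 :+ w8 :* :0 := :0) refl

  minor-scale : ∀ {M N : Mat} {b} → (∀ i j → M i j ≈ b * N i j) → ∀ i j k l → minor2 M i j k l ≈ (b * b) * minor2 N i j k l
  minor-scale h i j k l = trans (minor2-cong h i j k l) (identity _ _ _ _ _)
    where
    identity : ∀ b a₁ a₂ a₃ a₄ → (b * a₁) * (b * a₂) - (b * a₃) * (b * a₄) ≈ (b * b) * (a₁ * a₂ - a₃ * a₄)
    identity = solve 5 (λ b a₁ a₂ a₃ a₄ → (b :* a₁) :* (b :* a₂) :- (b :* a₃) :* (b :* a₄) := (b :* b) :* (a₁ :* a₂ :- a₃ :* a₄)) refl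

  det-scale : ∀ {M N : Mat} {b} → (∀ i j → M i j ≈ b * N i j) → det3 M ≈ (b * (b * b)) * det3 N
  det-scale h = trans (det3-cong h) (identity _ _ _ _ _ _ _ _ _ _)
    where
    identity : ∀ b m00 m01 m02 m10 m11 m12 m20 m21 m22 →
      Det₀ (b * m00) (b * m01) (b * m02) (b * m10) (b * m11) (b * m12) (b * m20) (b * m21) (b * m22)
      ≈ (b * (b * b)) * Det₀ m00 m01 m02 m10 m11 m12 m20 m21 m22
    identity = solve 10 (λ b m00 m01 m02 m10 m11 m12 m20 m21 m22 →
      :Det (b :* m00) (b :* m01) (b :* m02) (b :* m10) (b :* m11) (b :* m12) (b :* m20) (b :* m21) (b :* m22)
      := (b :* (b :* b)) :* :Det m00 m01 m02 m10 m11 m12 m20 m21 m22) refl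

  rank-scale : ∀ {M N : Mat} {b} r → b ≉ 0# → (∀ i j → M i j ≈ b * N i j) → HasRank M r → HasRank N r
  rank-scale 0 b≉0 h M≈0 i j = cancel-0 _ b≉0 (trans (sym (h i j)) (M≈0 i j))
  rank-scale 1 b≉0 h ((i , j , Mij≉0) , minors≈0) =
    (i , j , λ Nij≈0 → Mij≉0 (trans (h i j) (x*0≈0 Nij≈0))) ,
    λ i j k l → cancel-0 _ (sq-≉0 b≉0) (trans (sym (minor-scale h i j k l)) (minors≈0 i j k l))
  rank-scale 2 b≉0 h ((i , j , k , l , minor≉0) , det≈0) =
    (i , j , k , l , λ minor≈0 → minor≉0 (trans (minor-scale h i j k l) (x*0≈0 minor≈0))) ,
    cancel-0 _ (*-≉0 b≉0 (sq-≉0 b≉0)) (trans (sym (det-scale h)) det≈0)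
  rank-scale 3 b≉0 h det≉0 det≈0 = det≉0 (trans (det-scale h) (x*0≈0 det≈0))
  rank-scale (suc (suc (suc (suc _)))) _ _ (lift ())

  rank1-not-rank2 : ∀ {M} → HasRank M 1 → HasRank M 2 → ⊥
  rank1-not-rank2 (_ , minors≈0) ((i , j , k , l , minor≉0) , _) = minor≉0 (minors≈0 i j k l)

  rank1-not-rank3 : ∀ {M} → HasRank M 1 → HasRank M 3 → ⊥
  rank1-not-rank3 {M} (_ , minors≈0) det≉0 = det≉0 (minors-zero⇒det-zero M minors≈0)

  nonzero-minor : ∀ M → ¬ AllMinorsZero M → ∃₂ λ i j → ∃₂ λ k l → minor2 M i j k l ≉ 0#
  nonzero-minor M ¬zero
    with FinP.¬∀⟶∃¬ 3 _ (λ i → FinP.all? λ j → FinP.all? λ k → FinP.all? λ l → minor2 M i j k l ≟ 0#)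
           (λ all → ¬zero (λ i j k l → all i j k l))
  ... | i , ¬i with FinP.¬∀⟶∃¬ 3 _ (λ j → FinP.all? λ k → FinP.all? λ l → minor2 M i j k l ≟ 0#) ¬i
  ... | j , ¬j with FinP.¬∀⟶∃¬ 3 _ (λ k → FinP.all? λ l → minor2 M i j k l ≟ 0#) ¬j
  ... | k , ¬k with FinP.¬∀⟶∃¬ 3 _ (λ l → minor2 M i j k l ≟ 0#) ¬k
  ... | l , minor≉0 = i , j , k , l , minor≉0

  sp-refl : ∀ A → SamePoint A A
  sp-refl A = 1# , 1≉0 , λ i j → sym (*-identityˡ _)

  sp-trans : ∀ A B C → SamePoint A B → SamePoint B C → SamePoint A C
  sp-trans A B C (s , s≉0 , B≈sA) (t , t≉0 , C≈tB) =
    t * s , *-≉0 t≉0 s≉0 , λ i j → trans (C≈tB i j) (trans (*-congˡ (B≈sA i j)) (sym (*-assoc _ _ _)))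

  sp-sym : ∀ A B → SamePoint A B → SamePoint B A
  sp-sym A B (t , t≉0 , B≈tA) = inv t t≉0 , inv-≉0 t t≉0 , λ i j → trans (expand-invˡ t t≉0 _) (*-congˡ (sym (B≈tA i j)))

  sp-≈ : ∀ A B → (∀ i j → mat (vec B) i j ≈ mat (vec A) i j) → SamePoint A B
  sp-≈ A B h = 1# , 1≉0 , λ i j → trans (h i j) (sym (*-identityˡ _))

  rank-sp : ∀ r A B → SamePoint A B → PointRank B r → PointRank A r
  rank-sp r A B (t , t≉0 , B≈tA) = rank-scale r t≉0 B≈tA

  sl-refl : ∀ L → SameLine L L
  sl-refl L P = id , id

  sl-trans : ∀ L M N → SameLine L M → SameLine M N → SameLine L N
  sl-trans L M N L≡M M≡N P = proj₁ (M≡N P) ∘ proj₁ (L≡M P) , proj₂ (L≡M P) ∘ proj₂ (M≡N P)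

  -- a symmetric matrix of rank 1 is μ x xᵀ with μ ≠ 0 (x a column through a
  -- nonzero diagonal entry, which exists since Zᵢⱼ² = Zᵢᵢ Zⱼⱼ)
  rank1-symmetric : ∀ (Z : Point) → PointRank Z 1 →
    Σ V3 λ x → NonZero3 x × Σ Carrier λ μ → (μ ≉ 0#) × (∀ i j → mat (vec Z) i j ≈ μ * (x i * x j))
  rank1-symmetric Z ((i₀ , j₀ , Zij≉0) , minors≈0) with nonzero-diagonal
    where
    Zm = mat (vec Z)
    nonzero-diagonal : Σ (Fin 3) λ k → Zm k k ≉ 0#
    nonzero-diagonal with Zm 0F 0F ≟ 0# | Zm 1F 1F ≟ 0# | Zm 2F 2F ≟ 0#
    ... | no a  | _     | _     = 0F , a
    ... | yes _ | no a  | _     = 1F , a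
    ... | yes _ | yes _ | no a  = 2F , a
    ... | yes a | yes b | yes d = ⊥-elim (Zij≉0 (sq≈0 (begin
      Zm i₀ j₀ * Zm i₀ j₀  ≈⟨ *-congˡ (SG.sym (vec Z) i₀ j₀) ⟩
      Zm i₀ j₀ * Zm j₀ i₀  ≈⟨ sym (x-y≈0⇒x≈y (minors≈0 i₀ j₀ i₀ j₀)) ⟩
      Zm i₀ i₀ * Zm j₀ j₀  ≈⟨ 0*x≈0 (diagonal-0 i₀) ⟩
      0#                   ∎)))
      where
      diagonal-0 : ∀ i → Zm i i ≈ 0#
      diagonal-0 0F = a
      diagonal-0 1F = b
      diagonal-0 2F = d
  ... | k , Zkk≉0 = x , x≠0 , inv (Zm k k) Zkk≉0 , inv-≉0 _ Zkk≉0 , coordinates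
    where
    Zm = mat (vec Z)
    x : V3
    x i = Zm i k
    x≠0 : NonZero3 x
    x≠0 (a , b , d) = Zkk≉0 (column-0 k)
      where
      column-0 : ∀ i → x i ≈ 0#
      column-0 0F = a
      column-0 1F = b
      column-0 2F = d
    coordinates : ∀ i j → Zm i j ≈ inv (Zm k k) Zkk≉0 * (x i * x j)
    coordinates i j = trans (expand-invˡ _ Zkk≉0 _) (*-congˡ (begin
      Zm k k * Zm i j  ≈⟨ x-y≈0⇒x≈y (minors≈0 k i k j) ⟩
      Zm k j * Zm i k  ≈⟨ *-comm _ _ ⟩
      Zm i k * Zm k j  ≈⟨ *-congˡ (SG.sym (vec Z) k j) ⟩
      Zm i k * Zm j k  ∎))

  Independent : Vs → Vs → Set (c ⊔ ℓ)
  Independent U V = ∀ a b → (∀ i j → a * mat U i j + b * mat V i j ≈ 0#) → (a ≈ 0#) × (b ≈ 0#)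

  spanning-pair : ∀ (L : Line) U V (indep : Independent U V) → InSpan U (u L) (v L) → InSpan V (u L) (v L) →
                  SameLine L (mkLine U V indep)
  spanning-pair L U V indep (α , β , U≈) (γ , δ , V≈) W = to , from
    where
    D = α * δ - β * γ
    D≉0 : D ≉ 0#
    D≉0 D≈0 = 1≉0 (proj₁ (indep 1# 0# (λ i j → trans (+-cong (*-identityˡ _) (0*x≈0 refl)) (trans (+-identityʳ _)
                (trans (U≈ i j) (trans (+-cong (0*x≈0 α≈0) (0*x≈0 β≈0)) (+-identityʳ 0#)))))))
      where
      eliminate-v : ∀ α β γ δ a b → δ * (α * a + β * b) - β * (γ * a + δ * b) ≈ (α * δ - β * γ) * a
      eliminate-v = solve 6 (λ α β γ δ a b → δ :* (α :* a :+ β :* b) :- β :* (γ :* a :+ δ :* b) := (α :* δ :- β :* γ) :* a) refl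
      eliminate-u : ∀ α β γ δ a b → α * (γ * a + δ * b) - γ * (α * a + β * b) ≈ (α * δ - β * γ) * b
      eliminate-u = solve 6 (λ α β γ δ a b → α :* (γ :* a :+ δ :* b) :- γ :* (α :* a :+ β :* b) := (α :* δ :- β :* γ) :* b) refl
      -- δ U − β V = D u = 0 and −γ U + α V = D v = 0
      δU-βV : ∀ i j → δ * mat U i j + (- β) * mat V i j ≈ 0#
      δU-βV i j = trans (+-congˡ (sym (-‿distribˡ-* _ _))) (trans (+-cong (*-congˡ (U≈ i j)) (-‿cong (*-congˡ (V≈ i j))))
                    (trans (eliminate-v α β γ δ _ _) (0*x≈0 D≈0)))
      αV-γU : ∀ i j → (- γ) * mat U i j + α * mat V i j ≈ 0#
      αV-γU i j = trans (+-comm _ _) (trans (+-congˡ (sym (-‿distribˡ-* _ _))) (trans (+-cong (*-congˡ (V≈ i j)) (-‿cong (*-congˡ (U≈ i j))))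
                    (trans (eliminate-u α β γ δ _ _) (0*x≈0 D≈0))))
      β≈0 : β ≈ 0#
      β≈0 = -‿injective (trans (proj₂ (indep δ (- β) δU-βV)) (sym -0#≈0#))
      α≈0 : α ≈ 0#
      α≈0 = proj₂ (indep (- γ) α αV-γU)
    to : OnLine W L → InSpan (vec W) U V
    to (a , b , W≈) = inv D D≉0 * (a * δ - b * γ) , inv D D≉0 * (b * α - a * β) , λ i j → begin
      mat (vec W) i j                ≈⟨ W≈ i j ⟩
      a * mat (u L) i j + b * mat (v L) i j
                                     ≈⟨ expand-invˡ D D≉0 _ ⟩
      inv D D≉0 * (D * (a * mat (u L) i j + b * mat (v L) i j))
                                     ≈⟨ *-congˡ (change-basis a b α β γ δ _ _) ⟩
      inv D D≉0 * ((a * δ - b * γ) * (α * mat (u L) i j + β * mat (v L) i j) + (b * α - a * β) * (γ * mat (u L) i j + δ * mat (v L) i j))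
                                     ≈⟨ *-congˡ (+-cong (*-congˡ (sym (U≈ i j))) (*-congˡ (sym (V≈ i j)))) ⟩
      inv D D≉0 * ((a * δ - b * γ) * mat U i j + (b * α - a * β) * mat V i j)
                                     ≈⟨ distribˡ _ _ _ ⟩
      inv D D≉0 * ((a * δ - b * γ) * mat U i j) + inv D D≉0 * ((b * α - a * β) * mat V i j)
                                     ≈⟨ +-cong (sym (*-assoc _ _ _)) (sym (*-assoc _ _ _)) ⟩
      (inv D D≉0 * (a * δ - b * γ)) * mat U i j + (inv D D≉0 * (b * α - a * β)) * mat V i j ∎
      where
      change-basis : ∀ a b α β γ δ U V → (α * δ - β * γ) * (a * U + b * V) ≈ (a * δ - b * γ) * (α * U + β * V) + (b * α - a * β) * (γ * U + δ * V)
      change-basis = solve 8 (λ a b α β γ δ U V → (α :* δ :- β :* γ) :* (a :* U :+ b :* V) := (a :* δ :- b :* γ) :* (α :* U :+ β :* V) :+ (b :* α :- a :* β) :* (γ :* U :+ δ :* V)) refl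
    from : InSpan (vec W) U V → OnLine W L
    from (a , b , W≈) = a * α + b * γ , a * β + b * δ , λ i j →
      trans (W≈ i j) (trans (+-cong (*-congˡ (U≈ i j)) (*-congˡ (V≈ i j))) (substitute a b α β γ δ _ _))
      where
      substitute : ∀ a b α β γ δ U V → a * (α * U + β * V) + b * (γ * U + δ * V) ≈ (a * α + b * γ) * U + (a * β + b * δ) * V
      substitute = solve 8 (λ a b α β γ δ U V → a :* (α :* U :+ β :* V) :+ b :* (γ :* U :+ δ :* V) := (a :* α :+ b :* γ) :* U :+ (a :* β :+ b :* δ) :* V) refl

  xxᵀ-proportional : ∀ (x y : V3) α → NonZero3 x → NonZero3 y → (∀ i j → x i * x j ≈ α * (y i * y j)) → Prop3 x y
  xxᵀ-proportional x y α x≠0 y≠0 xx≈αyy = s , *-≉0 (inv-≉0 _ αyₖ≉0) xₖ≉0 , y≈sx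
    where
    k = proj₁ (nonzero-coordinate {y} y≠0)
    yₖ≉0 = proj₂ (nonzero-coordinate {y} y≠0)
    α≉0 : α ≉ 0#
    α≉0 α≈0 = x≠0 (zero-at 0F , zero-at 1F , zero-at 2F)
      where
      zero-at : ∀ i → x i ≈ 0#
      zero-at i = sq≈0 (trans (xx≈αyy i i) (0*x≈0 α≈0))
    xₖ≉0 : x k ≉ 0#
    xₖ≉0 xₖ≈0 = *-≉0 α≉0 (sq-≉0 yₖ≉0) (trans (sym (xx≈αyy k k)) (0*x≈0 xₖ≈0))
    αyₖ≉0 : α * y k ≉ 0#
    αyₖ≉0 = *-≉0 α≉0 yₖ≉0
    s = inv (α * y k) αyₖ≉0 * x k
    y≈sx : ∀ i → y i ≈ s * x i
    y≈sx i = begin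
      y i                                   ≈⟨ expand-invˡ (α * y k) αyₖ≉0 (y i) ⟩
      inv (α * y k) αyₖ≉0 * ((α * y k) * y i) ≈⟨ *-congˡ (regroup α (y k) (y i)) ⟩
      inv (α * y k) αyₖ≉0 * (α * (y i * y k)) ≈⟨ *-congˡ (sym (xx≈αyy i k)) ⟩
      inv (α * y k) αyₖ≉0 * (x i * x k)       ≈⟨ regroup′ _ _ _ ⟩
      s * x i                               ∎
      where
      regroup : ∀ α yk yi → (α * yk) * yi ≈ α * (yi * yk)
      regroup = solve 3 (λ α yk yi → (α :* yk) :* yi := α :* (yi :* yk)) refl
      regroup′ : ∀ a xi xk → a * (xi * xk) ≈ (a * xk) * xi
      regroup′ = solve 3 (λ a xi xk → a :* (xi :* xk) := (a :* xk) :* xi) refl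

  module ThroughRank3Point (Pt : Point) (P-rank3 : PointRank Pt 3) where
    Pm : Mat
    Pm = mat (vec Pt)

    P-sym : ∀ i j → Pm i j ≈ Pm j i
    P-sym = SG.sym (vec Pt)

    pa = Pm 0F 0F
    pb = Pm 0F 1F
    pc = Pm 0F 2F
    pd = Pm 1F 1F
    pe = Pm 1F 2F
    pf = Pm 2F 2F

    Δ : Carrier
    Δ = D₀ pa pb pc pd pe pf

    det≈Δ : det3 Pm ≈ Δ
    det≈Δ = Det₀-cong refl refl refl (P-sym 1F 0F) refl refl (P-sym 2F 0F) (P-sym 2F 1F) refl

    Δ≉0 : Δ ≉ 0#
    Δ≉0 Δ≈0 = P-rank3 (trans det≈Δ Δ≈0)

    -- the adjugate of P and its quadratic form QA(x) = xᵀ adj(P) x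
    A00 = pd * pf - pe * pe
    A01 = pc * pe - pb * pf
    A02 = pb * pe - pc * pd
    A11 = pa * pf - pc * pc
    A12 = pb * pc - pa * pe
    A22 = pa * pd - pb * pb

    QA : V3 → Carrier
    QA = Form.Q A00 A01 A02 A11 A12 A22

    -- det adj P = (det P)² ≠ 0
    adjugate-nondegenerate : D₀ A00 A01 A02 A11 A12 A22 ≉ 0#
    adjugate-nondegenerate det≈0 = sq-≉0 Δ≉0 (trans (sym (det-adjugate pa pb pc pd pe pf)) det≈0)
      where
      det-adjugate : ∀ a b d e f g →
        D₀ (e * g - f * f) (d * f - b * g) (b * f - d * e) (a * g - d * d) (b * d - a * f) (a * e - b * b) ≈ D₀ a b d e f g * D₀ a b d e f g
      det-adjugate = solve 6 (λ a b d e f g →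
        :SymDet (e :* g :- f :* f) (d :* f :- b :* g) (b :* f :- d :* e) (a :* g :- d :* d) (b :* d :- a :* f) (a :* e :- b :* b)
        := :SymDet a b d e f g :* :SymDet a b d e f g) refl

    xxᵀ : V3 → Vs
    xxᵀ x = mkVs (λ i j → x i * x j) (λ i j → *-comm _ _)

    P+txxᵀ : V3 → Carrier → Vs
    P+txxᵀ x t = mkVs (λ i j → Pm i j + t * (x i * x j)) (λ i j → +-cong (P-sym i j) (*-congˡ (*-comm _ _)))

    P-not-rank≤1+yyᵀ : ∀ M s (y : V3) → AllMinorsZero M → ¬ (∀ i j → Pm i j ≈ M i j + s * (y i * y j))
    P-not-rank≤1+yyᵀ M s y M-rank≤1 P≈ = P-rank3 (trans (det3-cong P≈) (rank≤1-sum-singular M s y M-rank≤1))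

    P-not-rank1 : ∀ s (y : V3) → ¬ (∀ i j → Pm i j ≈ s * (y i * y j))
    P-not-rank1 s y P≈ = P-not-rank≤1+yyᵀ (λ _ _ → 0#) s y (zero-minors-zero _ (λ _ _ → refl)) (λ i j → trans (P≈ i j) (sym (+-identityˡ _)))

    pencil-not-rank≤1 : ∀ x t → ¬ AllMinorsZero (mat (P+txxᵀ x t))
    pencil-not-rank≤1 x t rank≤1 = P-not-rank≤1+yyᵀ (mat (P+txxᵀ x t)) (- t) x rank≤1 (λ i j → undo _ _ _)
      where
      undo : ∀ a t w → a ≈ (a + t * w) + (- t) * w
      undo = solve 3 (λ a t w → a := (a :+ t :* w) :+ (:- t) :* w) refl

    nonzero-square : ∀ (x : V3) → NonZero3 x → Σ (Fin 3) λ k → x k * x k ≉ 0#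
    nonzero-square x x≠0 = proj₁ (nonzero-coordinate {x} x≠0) , sq-≉0 (proj₂ (nonzero-coordinate {x} x≠0))

    rank1-point : (x : V3) → NonZero3 x → Point
    rank1-point x x≠0 = mkPoint (xxᵀ x) (λ z → proj₂ (nonzero-square x x≠0) (z (proj₁ (nonzero-square x x≠0)) (proj₁ (nonzero-square x x≠0))))

    pencil-point : V3 → Carrier → Point
    pencil-point x t = mkPoint (P+txxᵀ x t) (λ z → pencil-not-rank≤1 x t (zero-minors-zero _ z))

    det-pencil : ∀ x t → det3 (mat (P+txxᵀ x t)) ≈ Δ + t * QA x
    det-pencil x t = trans (Det₀-cong refl refl refl (+-congʳ (P-sym 1F 0F)) refl refl (+-congʳ (P-sym 2F 0F)) (+-congʳ (P-sym 2F 1F)) refl)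
                           (identity pa pb pc pd pe pf t (x 0F) (x 1F) (x 2F))
      where
      identity : ∀ a b d e f g t x0 x1 x2 →
        Det₀ (a + t * (x0 * x0)) (b + t * (x0 * x1)) (d + t * (x0 * x2))
             (b + t * (x1 * x0)) (e + t * (x1 * x1)) (f + t * (x1 * x2))
             (d + t * (x2 * x0)) (f + t * (x2 * x1)) (g + t * (x2 * x2))
        ≈ D₀ a b d e f g + t * Q₀ (e * g - f * f) (d * f - b * g) (b * f - d * e) (a * g - d * d) (b * d - a * f) (a * e - b * b) x0 x1 x2
      identity = solve 10 (λ a b d e f g t x0 x1 x2 →
        :Det (a :+ t :* (x0 :* x0)) (b :+ t :* (x0 :* x1)) (d :+ t :* (x0 :* x2))
             (b :+ t :* (x1 :* x0)) (e :+ t :* (x1 :* x1)) (f :+ t :* (x1 :* x2))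
             (d :+ t :* (x2 :* x0)) (f :+ t :* (x2 :* x1)) (g :+ t :* (x2 :* x2))
        := :SymDet a b d e f g :+ t :* :Quad (e :* g :- f :* f) (d :* f :- b :* g) (b :* f :- d :* e) (a :* g :- d :* d) (b :* d :- a :* f) (a :* e :- b :* b) x0 x1 x2) refl

    rank1-point-rank : ∀ x x≠0 → PointRank (rank1-point x x≠0) 1
    rank1-point-rank x x≠0 = (k , k , proj₂ (nonzero-square x x≠0)) , λ i j k l → minor-0 (x i) (x j) (x k) (x l)
      where
      k = proj₁ (nonzero-square x x≠0)
      minor-0 : ∀ a b d f → (a * d) * (b * f) - (a * f) * (b * d) ≈ 0#
      minor-0 = solve 4 (λ a b d f → (a :* d) :* (b :* f) :- (a :* f) :* (b :* d) := :0) refl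

    pencil-rank3 : ∀ x t → Δ + t * QA x ≉ 0# → PointRank (pencil-point x t) 3
    pencil-rank3 x t det≉0 det≈0 = det≉0 (trans (sym (det-pencil x t)) det≈0)

    pencil-rank2 : ∀ x t → Δ + t * QA x ≈ 0# → PointRank (pencil-point x t) 2
    pencil-rank2 x t det≈0 = nonzero-minor _ (pencil-not-rank≤1 x t) , trans (det-pencil x t) det≈0

    pencil-not-rank1 : ∀ x t → ¬ PointRank (pencil-point x t) 1
    pencil-not-rank1 x t (_ , rank≤1) = pencil-not-rank≤1 x t rank≤1

    pencil-same : ∀ x {t t'} → t ≈ t' → SamePoint (pencil-point x t) (pencil-point x t')
    pencil-same x t≈t' = sp-≈ (pencil-point x _) (pencil-point x _) (λ i j → +-congˡ (*-congʳ (sym t≈t')))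

    xxᵀ-P-independent : ∀ (x : V3) → NonZero3 x → Independent (xxᵀ x) (vec Pt)
    xxᵀ-P-independent x x≠0 a b a·xxᵀ+b·P≈0 with b ≟ 0#
    ... | no b≉0 = ⊥-elim (P-not-rank1 (- (a * inv b b≉0)) x λ i j → solve-for-P (x+y≈0⇒y≈-x (a·xxᵀ+b·P≈0 i j)))
      where
      solve-for-P : ∀ {w p} → b * p ≈ - (a * w) → p ≈ (- (a * inv b b≉0)) * w
      solve-for-P {w} {p} e = trans (expand-invˡ b b≉0 p) (trans (*-congˡ e) (regroup a w (inv b b≉0)))
        where
        regroup : ∀ a w i → i * (- (a * w)) ≈ (- (a * i)) * w
        regroup = solve 3 (λ a w i → i :* (:- (a :* w)) := (:- (a :* i)) :* w) refl
    ... | yes b≈0 = cancel-0 _ (proj₂ (nonzero-square x x≠0))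
                      (trans (*-comm _ _) (trans (sym (+-identityʳ _)) (trans (+-congˡ (sym (0*x≈0 b≈0))) (a·xxᵀ+b·P≈0 k k)))) , b≈0
      where k = proj₁ (nonzero-square x x≠0)

    L : (x : V3) → NonZero3 x → Line
    L x x≠0 = mkLine (xxᵀ x) (vec Pt) (xxᵀ-P-independent x x≠0)

    P-on-L : ∀ x x≠0 → OnLine Pt (L x x≠0)
    P-on-L x x≠0 = 0# , 1# , λ i j → sym (trans (+-cong (zeroˡ _) (*-identityˡ _)) (+-identityˡ _))

    rank1-on-L : ∀ x x≠0 → OnLine (rank1-point x x≠0) (L x x≠0)
    rank1-on-L x x≠0 = 1# , 0# , λ i j → sym (trans (+-cong (*-identityˡ _) (zeroˡ _)) (+-identityʳ _))

    pencil-on-L : ∀ x x≠0 t → OnLine (pencil-point x t) (L x x≠0)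
    pencil-on-L x x≠0 t = t , 1# , λ i j → trans (+-comm _ _) (+-congˡ (sym (*-identityˡ _)))

    points-of-L : ∀ x x≠0 Z → OnLine Z (L x x≠0) → SamePoint (rank1-point x x≠0) Z ⊎ Σ Carrier λ t → SamePoint (pencil-point x t) Z
    points-of-L x x≠0 Z (α , β , Z≈) with β ≟ 0#
    ... | yes β≈0 = inj₁ (α , α≉0 , Z≈αxxᵀ)
      where
      Z≈αxxᵀ : ∀ i j → mat (vec Z) i j ≈ α * (x i * x j)
      Z≈αxxᵀ i j = trans (Z≈ i j) (trans (+-congˡ (0*x≈0 β≈0)) (+-identityʳ _))
      α≉0 : α ≉ 0#
      α≉0 α≈0 = nonzero Z (λ i j → trans (Z≈αxxᵀ i j) (0*x≈0 α≈0))
    ... | no β≉0 = inj₂ (α * inv β β≉0 , β , β≉0 , λ i j → trans (Z≈ i j) (factor α _ β _ (inv β β≉0) (inv-r β β≉0)))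
      where
      factor : ∀ α w β p i → β * i ≈ 1# → α * w + β * p ≈ β * (p + (α * i) * w)
      factor α w β p i βi≈1 = begin
        α * w + β * p              ≈⟨ +-comm _ _ ⟩
        β * p + α * w              ≈⟨ +-congˡ (sym (trans (*-congʳ βi≈1) (*-identityˡ _))) ⟩
        β * p + (β * i) * (α * w)  ≈⟨ identity _ _ _ _ _ ⟩
        β * (p + (α * i) * w)      ∎
        where
        identity : ∀ β p i α w → β * p + (β * i) * (α * w) ≈ β * (p + (α * i) * w)
        identity = solve 5 (λ β p i α w → β :* p :+ (β :* i) :* (α :* w) := β :* (p :+ (α :* i) :* w)) refl

    pencil-inj : ∀ x x≠0 t t' → SamePoint (pencil-point x t) (pencil-point x t') → t ≈ t'
    pencil-inj x x≠0 t t' (l , _ , h) with 1# - l ≟ 0#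
    ... | no 1-l≉0 = ⊥-elim (P-not-rank1 (inv _ 1-l≉0 * (l * t - t')) x λ i j →
            trans (expand-invˡ _ 1-l≉0 _) (trans (*-congˡ (x-y≈0⇒x≈y (trans (rearrange _ t t' l _) (x≈y⇒x-y≈0 (h i j)))))
                  (sym (*-assoc _ _ _))))
      where
      rearrange : ∀ p t t' l w → ((1# - l) * p - (l * t - t') * w) ≈ (p + t' * w) - l * (p + t * w)
      rearrange = solve 5 (λ p t t' l w → ((:1 :- l) :* p :- (l :* t :- t') :* w) := (p :+ t' :* w) :- l :* (p :+ t :* w)) refl
    ... | yes 1-l≈0 = sym (cancelˡ _ (proj₂ (nonzero-square x x≠0))
                        (trans (*-comm _ _) (trans (+-cancelˡ (Pm k k) (trans (h k k) l≈1-scale)) (*-comm _ _))))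
      where
      k = proj₁ (nonzero-square x x≠0)
      l≈1-scale : l * (Pm k k + t * (x k * x k)) ≈ Pm k k + t * (x k * x k)
      l≈1-scale = trans (*-congʳ (sym (x-y≈0⇒x≈y 1-l≈0))) (*-identityˡ _)

    one-rank1-point : ∀ x x≠0 → PointsOfRank (L x x≠0) 1 1
    one-rank1-point x x≠0 = (λ _ → rank1-point x x≠0) , (λ _ → rank1-on-L x x≠0 , rank1-point-rank x x≠0) ,
                            (λ { fz fz _ → ≡.refl }) , represented
      where
      represented : ∀ Z → OnLine Z (L x x≠0) × PointRank Z 1 → Σ (Fin 1) λ i → SamePoint Z (rank1-point x x≠0)
      represented Z (Z∈L , Z-rank1) with points-of-L x x≠0 Z Z∈L
      ... | inj₁ same = fz , sp-sym (rank1-point x x≠0) Z same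
      ... | inj₂ (t , same) = ⊥-elim (pencil-not-rank1 x t (rank-sp 1 (pencil-point x t) Z same Z-rank1))

    -- The points of rank 2 (resp. 3) on L(x) are the P + t x xᵀ with t a
    -- root (resp. a non-root) of the linear function t ↦ Δ + t QA(x).
    Root : V3 → Carrier → Set ℓ
    Root x t = Δ + t * QA x ≈ 0#

    pencil-points : ∀ x x≠0 r (R : Carrier → Set ℓ) {n} →
      (∀ t → R t → PointRank (pencil-point x t) r) →
      (∀ t → PointRank (pencil-point x t) r → R t) →
      (∀ {t t'} → t ≈ t' → R t → R t') →
      (¬ PointRank (rank1-point x x≠0) r) →
      Exactly (Fin q) _≡_ (R ∘ elem) n → PointsOfRank (L x x≠0) r n
    pencil-points x x≠0 r R R⇒rank rank⇒R R-resp not-rank1 count =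
      transport-Fin {E = SamePoint} (λ {A} → sp-refl A) (λ {A} {B} {C} → sp-trans A B C) count point on-L injective surjective
      where
      point : Fin q → Point
      point j = pencil-point x (elem j)
      on-L : ∀ j → R (elem j) → OnLine (point j) (L x x≠0) × PointRank (point j) r
      on-L j Rj = pencil-on-L x x≠0 (elem j) , R⇒rank (elem j) Rj
      injective : ∀ i j → _ → _ → SamePoint (point i) (point j) → i ≡ j
      injective i j _ _ same = elem-inj i j (pencil-inj x x≠0 (elem i) (elem j) same)
      surjective : ∀ Z → OnLine Z (L x x≠0) × PointRank Z r → Σ (Fin q) λ j → R (elem j) × SamePoint Z (point j)
      surjective Z (Z∈L , Z-rank) with points-of-L x x≠0 Z Z∈L
      ... | inj₁ same = ⊥-elim (not-rank1 (rank-sp r (rank1-point x x≠0) Z same Z-rank))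
      ... | inj₂ (t , same) = index t , R-resp (index-≈ t) (rank⇒R t (rank-sp r (pencil-point x t) Z same Z-rank)) ,
                              sp-trans Z (pencil-point x t) (point (index t)) (sp-sym (pencil-point x t) Z same) (pencil-same x (index-≈ t))

    Root-resp : ∀ x {t t'} → t ≈ t' → Root x t → Root x t'
    Root-resp x t≈t' = trans (+-congˡ (*-congʳ (sym t≈t')))

    rank2-points : ∀ x x≠0 {n} → Exactly (Fin q) _≡_ (Root x ∘ elem) n → PointsOfRank (L x x≠0) 2 n
    rank2-points x x≠0 = pencil-points x x≠0 2 (Root x) (pencil-rank2 x) (λ t rank2 → trans (sym (det-pencil x t)) (proj₂ rank2))
                           (Root-resp x) (rank1-not-rank2 (rank1-point-rank x x≠0))

    rank3-points : ∀ x x≠0 {n} → Exactly (Fin q) _≡_ (λ j → ¬ Root x (elem j)) n → PointsOfRank (L x x≠0) 3 n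
    rank3-points x x≠0 = pencil-points x x≠0 3 (λ t → ¬ Root x t) (pencil-rank3 x) (λ t rank3 root → rank3 (trans (det-pencil x t) root))
                           (λ t≈t' ¬root root → ¬root (Root-resp x (sym t≈t') root)) (rank1-not-rank3 (rank1-point-rank x x≠0))

    module Secant (x : V3) (x≠0 : NonZero3 x) (QAx≉0 : QA x ≉ 0#) where
      t₀ : Carrier
      t₀ = - (Δ * inv (QA x) QAx≉0)

      t₀-root : Root x t₀
      t₀-root = trans (expand Δ (QA x) _) (trans (+-congˡ (-‿cong (trans (*-congˡ (inv-r _ QAx≉0)) (*-identityʳ _)))) (-‿inverseʳ Δ))
        where
        expand : ∀ D Q i → D + (- (D * i)) * Q ≈ D - D * (Q * i)
        expand = solve 3 (λ D Q i → D :+ (:- (D :* i)) :* Q := D :- D :* (Q :* i)) refl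

      root-unique : ∀ {t} → Root x t → t ≈ t₀
      root-unique {t} root = begin
        t                                 ≈⟨ expand-invʳ (QA x) QAx≉0 t ⟩
        QA x * (inv (QA x) QAx≉0 * t)     ≈⟨ *-congˡ (*-comm _ _) ⟩
        QA x * (t * inv (QA x) QAx≉0)     ≈⟨ sym (*-assoc _ _ _) ⟩
        (QA x * t) * inv (QA x) QAx≉0     ≈⟨ *-congʳ (trans (*-comm _ _) (x+y≈0⇒y≈-x root)) ⟩
        (- Δ) * inv (QA x) QAx≉0          ≈⟨ sym (-‿distribˡ-* _ _) ⟩
        t₀                                ∎

      roots : Exactly (Fin q) _≡_ (Root x ∘ elem) 1
      roots = (λ _ → index t₀) , (λ _ → Root-resp x (index-≈ t₀) t₀-root) , (λ { fz fz _ → ≡.refl }) ,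
              λ j root → fz , elem-inj _ _ (trans (root-unique root) (index-≈ t₀))

      distribution : RankDistribution (L x x≠0) 1 1 (q ∸ 1)
      distribution = one-rank1-point x x≠0 , rank2-points x x≠0 roots ,
                     rank3-points x x≠0 (complement-count q (Root x ∘ elem) (λ j → Δ + elem j * QA x ≟ 0#) roots)

    -- a tangent line (QA x = 0): Δ + t QA(x) = Δ ≠ 0 has no root
    module Tangent (x : V3) (x≠0 : NonZero3 x) (QAx≈0 : QA x ≈ 0#) where
      no-root : ∀ t → ¬ Root x t
      no-root t root = Δ≉0 (trans (sym (trans (+-congˡ (x*0≈0 QAx≈0)) (+-identityʳ Δ))) root)

      roots : Exactly (Fin q) _≡_ (Root x ∘ elem) 0
      roots = (λ ()) , (λ ()) , (λ ()) , λ j root → ⊥-elim (no-root (elem j) root)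

      distribution : RankDistribution (L x x≠0) 1 0 q
      distribution = one-rank1-point x x≠0 , rank2-points x x≠0 roots ,
                     rank3-points x x≠0 (complement-count q (Root x ∘ elem) (λ j → Δ + elem j * QA x ≟ 0#) roots)

    L-inj : ∀ x x≠0 y y≠0 → SameLine (L x x≠0) (L y y≠0) → Prop3 x y
    L-inj x x≠0 y y≠0 same with proj₁ (same (rank1-point x x≠0)) (rank1-on-L x x≠0)
    ... | α , β , xx≈ with β ≟ 0#
    ...   | yes β≈0 = xxᵀ-proportional x y α x≠0 y≠0 (λ i j → trans (xx≈ i j) (trans (+-congˡ (0*x≈0 β≈0)) (+-identityʳ _)))
    ...   | no β≉0 = ⊥-elim (P-not-rank≤1+yyᵀ (λ i j → inv β β≉0 * (x i * x j)) (- (α * inv β β≉0)) y (xxᵀ-minors-zero (inv β β≉0) x)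
                      (λ i j → sym (trans (+-congʳ (*-congˡ (xx≈ i j))) (trans (solve-for-P _ _ _ _ _) (trans (*-congʳ (inv-l β β≉0)) (*-identityˡ _))))))
      where
      solve-for-P : ∀ i α v β p → i * (α * v + β * p) + (- (α * i)) * v ≈ (i * β) * p
      solve-for-P = solve 5 (λ i α v β p → i :* (α :* v :+ β :* p) :+ (:- (α :* i)) :* v := (i :* β) :* p) refl

    L-resp : ∀ x x≠0 y y≠0 → Prop3 x y → SameLine (L x x≠0) (L y y≠0)
    L-resp x x≠0 y y≠0 (t , _ , y≈tx) =
      spanning-pair (L x x≠0) (xxᵀ y) (vec Pt) (xxᵀ-P-independent y y≠0) (t * t , 0# , yy∈L) (P-on-L x x≠0)
      where
      yy∈L : ∀ i j → y i * y j ≈ (t * t) * (x i * x j) + 0# * Pm i j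
      yy∈L i j = trans (*-cong (y≈tx i) (y≈tx j)) (trans (regroup t (x i) (x j)) (sym (trans (+-congˡ (zeroˡ _)) (+-identityʳ _))))
        where
        regroup : ∀ t a b → (t * a) * (t * b) ≈ (t * t) * (a * b)
        regroup = solve 3 (λ t a b → (t :* a) :* (t :* b) := (t :* t) :* (a :* b)) refl

    L-surj : ∀ (L' : Line) → OnLine Pt L' → (Z : Point) → OnLine Z L' → PointRank Z 1 →
             Σ V3 λ x → Σ (NonZero3 x) λ x≠0 → SameLine L' (L x x≠0)
    L-surj L' P∈L' Z (α , β , Z≈) Z-rank1 with rank1-symmetric Z Z-rank1
    ... | x , x≠0 , μ , μ≉0 , Z≈μxx = x , x≠0 , spanning-pair L' (xxᵀ x) (vec Pt) (xxᵀ-P-independent x x≠0) xx∈L' P∈L'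
      where
      xx∈L' : InSpan (xxᵀ x) (u L') (v L')
      xx∈L' = inv μ μ≉0 * α , inv μ μ≉0 * β , λ i j → begin
        x i * x j                                   ≈⟨ expand-invˡ μ μ≉0 _ ⟩
        inv μ μ≉0 * (μ * (x i * x j))               ≈⟨ *-congˡ (sym (Z≈μxx i j)) ⟩
        inv μ μ≉0 * mat (vec Z) i j                 ≈⟨ *-congˡ (Z≈ i j) ⟩
        inv μ μ≉0 * (α * mat (u L') i j + β * mat (v L') i j)
                                                    ≈⟨ distribˡ _ _ _ ⟩
        inv μ μ≉0 * (α * mat (u L') i j) + inv μ μ≉0 * (β * mat (v L') i j)
                                                    ≈⟨ +-cong (sym (*-assoc _ _ _)) (sym (*-assoc _ _ _)) ⟩
        (inv μ μ≉0 * α) * mat (u L') i j + (inv μ μ≉0 * β) * mat (v L') i j ∎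

    secant-if-rank2 : ∀ x x≠0 Z → OnLine Z (L x x≠0) → PointRank Z 2 → QA x ≉ 0#
    secant-if-rank2 x x≠0 Z Z∈L Z-rank2 QAx≈0 with points-of-L x x≠0 Z Z∈L
    ... | inj₁ same = rank1-not-rank2 (rank1-point-rank x x≠0) (rank-sp 2 (rank1-point x x≠0) Z same Z-rank2)
    ... | inj₂ (t , same) = Tangent.no-root x x≠0 QAx≈0 t (trans (sym (det-pencil x t)) (proj₂ (rank-sp 2 (pencil-point x t) Z same Z-rank2)))

    tangent-if-no-rank2 : ∀ (L' : Line) x x≠0 → SameLine L' (L x x≠0) → PointsOfRank L' 2 0 → QA x ≈ 0#
    tangent-if-no-rank2 L' x x≠0 same (_ , _ , _ , represented) with QA x ≟ 0#
    ... | yes QAx≈0 = QAx≈0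
    ... | no QAx≉0 = ⊥-elim (Fin0-empty (proj₁ (represented (pencil-point x t₀) (proj₂ (same (pencil-point x t₀)) (pencil-on-L x x≠0 t₀) , pencil-rank2 x t₀ t₀-root))))
      where
      open Secant x x≠0 QAx≉0
      Fin0-empty : Fin 0 → ⊥
      Fin0-empty ()

    count-lines : ∀ (S : V3 → Set ℓ) a₂ a₃ {n} → (∀ {x y} → Prop3 x y → S x → S y) →
      (∀ x x≠0 → S x → RankDistribution (L x x≠0) 1 a₂ a₃) →
      (∀ L' x x≠0 → SameLine L' (L x x≠0) → RankDistribution L' 1 a₂ a₃ → S x) →
      Exactly (Fin N2) _≡_ (S ∘ point2) n → LinesThroughWithDist Pt 1 a₂ a₃ n
    count-lines S a₂ a₃ S-resp S⇒type type⇒S count =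
      transport-Fin {E = SameLine} (λ {L'} → sl-refl L') (λ {L₁} {L₂} {L₃} → sl-trans L₁ L₂ L₃) count line on-line injective surjective
      where
      line : Fin N2 → Line
      line i = L (point2 i) (point2-nonzero i)
      on-line : ∀ i → S (point2 i) → OnLine Pt (line i) × RankDistribution (line i) 1 a₂ a₃
      on-line i Si = P-on-L (point2 i) (point2-nonzero i) , S⇒type (point2 i) (point2-nonzero i) Si
      injective : ∀ i j → S (point2 i) → S (point2 j) → SameLine (line i) (line j) → i ≡ j
      injective i j _ _ same = point2-inj i j (L-inj (point2 i) (point2-nonzero i) (point2 j) (point2-nonzero j) same)
      surjective : ∀ L' → OnLine Pt L' × RankDistribution L' 1 a₂ a₃ → Σ (Fin N2) λ i → S (point2 i) × SameLine L' (line i)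
      surjective L' (P∈L' , type@((Z , ZP , _ , _) , _)) with L-surj L' P∈L' (Z fz) (proj₁ (ZP fz)) (proj₂ (ZP fz))
      ... | x , x≠0 , L'≡Lx with point2-surj x x≠0
      ...   | i , x′∼x = i , S-resp (Prop3-sym x′∼x) (type⇒S L' x x≠0 L'≡Lx type) ,
                         sl-trans L' (L x x≠0) (line i) L'≡Lx (L-resp x x≠0 (point2 i) (point2-nonzero i) (Prop3-sym x′∼x))

    QA≈0-resp : ∀ {x y} → Prop3 x y → QA x ≈ 0# → QA y ≈ 0#
    QA≈0-resp = Form.Q≈0-resp A00 A01 A02 A11 A12 A22

    QA≉0-resp : ∀ {x y} → Prop3 x y → QA x ≉ 0# → QA y ≉ 0#
    QA≉0-resp x∼y QAx≉0 QAy≈0 = QAx≉0 (QA≈0-resp (Prop3-sym x∼y) QAy≈0)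

    secant-lines : ∀ {n} → Exactly (Fin N2) _≡_ (λ i → QA (point2 i) ≉ 0#) n → LinesThroughWithDist Pt 1 1 (q ∸ 1) n
    secant-lines = count-lines (λ x → QA x ≉ 0#) 1 (q ∸ 1) QA≉0-resp Secant.distribution
      λ { L' x x≠0 L'≡Lx (_ , (W , WP , _ , _) , _) →
            secant-if-rank2 x x≠0 (W fz) (proj₁ (L'≡Lx (W fz)) (proj₁ (WP fz))) (proj₂ (WP fz)) }

    tangent-lines : ∀ {n} → Exactly (Fin N2) _≡_ (λ i → QA (point2 i) ≈ 0#) n → LinesThroughWithDist Pt 1 0 q n
    tangent-lines = count-lines (λ x → QA x ≈ 0#) 0 q QA≈0-resp Tangent.distribution
      λ L' x x≠0 L'≡Lx (_ , no-rank2 , _) → tangent-if-no-rank2 L' x x≠0 L'≡Lx no-rank2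

    on-conic : Exactly (Fin N2) _≡_ (λ i → QA (point2 i) ≈ 0#) (q ℕ.+ 1)
    on-conic = count-on-PG2 (λ x → QA x ≈ 0#) QA≈0-resp
                 (conic-count A00 A01 A02 A11 A12 A22 adjugate-nondegenerate)

    off-conic : Exactly (Fin N2) _≡_ (λ i → QA (point2 i) ≉ 0#) (q ℕ.* q)
    off-conic = ≡.subst (Exactly (Fin N2) _≡_ (λ i → QA (point2 i) ≉ 0#)) (ℕP.m+n∸n≡m (q ℕ.* q) (q ℕ.+ 1))
                  (complement-count N2 (λ i → QA (point2 i) ≈ 0#) (λ i → QA (point2 i) ≟ 0#) on-conic)

open import Data.Nat using (_+_)

lemma4p1 : ∀ {c ℓ} (R : CommutativeRing c ℓ) (q : ℕ) →
    IsPrimePower q →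
    FieldDefs.IsFiniteField R q →
    (P : SymGeometry.Point R) → SymGeometry.PointRank R P 3 →
    SymGeometry.LinesThroughWithDist R P 1 1 (q ∸ 1) (q ^ 2)
      × SymGeometry.LinesThroughWithDist R P 1 0 q (q + 1)
lemma4p1 R q _ ff P P-rank3 =
  ≡.subst (SymGeometry.LinesThroughWithDist R P 1 1 (q ∸ 1)) q*q≡q² (secant-lines off-conic) , tangent-lines on-conic
  where
  open Geometry R q ff
  open ThroughRank3Point P P-rank3
  q*q≡q² : q ℕ.* q ≡ q ^ 2
  q*q≡q² = ≡.cong (q ℕ.*_) (≡.sym (ℕP.*-identityʳ q))
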